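{- Let $D>0$ be a non-square discriminant. For every integral form $q$ of discriminant $D$, the sequence obtained from $q$ by the simple reduction algorithm described in the context becomes periodic, and its cycle consists of simply reduced forms equivalent to $q$; thus every form of discriminant $D$ is explicitly equivalent to a cycle of simply reduced forms. Two forms of discriminant $D$ are equivalent if and only if their cycles of simply reduced forms agree.
   Context: Forms $[a,b,c]=ax^2+bxy+cy^2$ have integer coefficients, discriminant $D=b^2-4ac$ (here $D>0$ not a square, so $a,c\ne0$). For $M=\begin{pmatrix}\alpha&\beta\\\gamma&\delta\end{pmatrix}$, $q|M(x,y):=q(\alpha x+\beta y,\gamma x+\delta y)$; $q_1\sim q_2$ if $q_1=q_2|M$ for some $M\in\mathrm{SL}(2,\mathbb{Z})$. $L=\begin{pmatrix}1&1\\0&1\end{pmatrix}$, $R=\begin{pmatrix}1&0\\1&1\end{pmatrix}$. For $q=[a,b,c]$ define $M_L(q)=L^k$ with $k=\lfloor\frac{ -b+\sqrt D}{2a}\rfloor$ and $M_R(q)=R^k$ with $k=\lfloor-\frac{b+\sqrt D}{2c}\rfloor$. A form $[a,b,c]$ is simply reduced if $a>0>c$ and $|a+c|<|b|$. Simple reduction algorithm: starting from $q$, apply alternately $q\mapsto q|M_L(q)$, $q\mapsto q|M_R(q)$, $q\mapsto q|M_L(q)$, etc., and stop when the resulting sequence becomes periodic; the output is the cycle (periodic part) of forms. -}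

module Defs where

open import Data.Nat as ℕ using (ℕ; zero; suc; _≤?_)
open import Data.Integer as ℤ using (ℤ; +_; -[1+_]; 0ℤ; 1ℤ; _+_; _-_; _*_; -_; _/ℕ_; ∣_∣)
open import Data.Bool using (if_then_else_)
open import Data.Product using (Σ; ∃-syntax; _×_)
open import Relation.Nullary.Decidable using (⌊_⌋)
open import Relation.Binary.PropositionalEquality using (_≡_)

-- binary quadratic form [a,b,c] = a x^2 + b x y + c y^2
record Form : Set where
  constructor [_,_,_]
  field
    a b c : ℤ
open Form public

disc : Form → ℤ
disc q = b q * b q - + 4 * a q * c q

record Mat : Set where
  constructor mat
  field
    α β γ δ : ℤ
open Mat public

det : Mat → ℤ
det M = α M * δ M - β M * γ M

-- q|M (x,y) = q(αx+βy, γx+δy), coefficients expanded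
_∣∣_ : Form → Mat → Form
[ a₀ , b₀ , c₀ ] ∣∣ mat α₀ β₀ γ₀ δ₀ =
  [ a₀ * α₀ * α₀ + b₀ * α₀ * γ₀ + c₀ * γ₀ * γ₀
  , + 2 * a₀ * α₀ * β₀ + b₀ * (α₀ * δ₀ + β₀ * γ₀) + + 2 * c₀ * γ₀ * δ₀
  , a₀ * β₀ * β₀ + b₀ * β₀ * δ₀ + c₀ * δ₀ * δ₀ ]

_∼_ : Form → Form → Set
q₁ ∼ q₂ = ∃[ M ] (det M ≡ 1ℤ × q₁ ≡ q₂ ∣∣ M)

Lpow : ℤ → Mat
Lpow k = mat 1ℤ k 0ℤ 1ℤ

Rpow : ℤ → Mat
Rpow k = mat 1ℤ 0ℤ k 1ℤ

isqrt : ℕ → ℕ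
isqrt zero = zero
isqrt (suc n) with isqrt n
... | r = if ⌊ suc r ℕ.* suc r ≤? suc n ⌋ then suc r else r

-- floorPlus D t m = ⌊ (t + √D) / m ⌋  for m ≠ 0 and D a non-square
-- (√D irrational, s = ⌊√D⌋ : for m > 0 this is ⌊(t+s)/m⌋, for m < 0 it is
--  ⌊(-t-√D)/|m|⌋ = ⌊(-t-s-1)/|m|⌋).  The value for m = 0 is irrelevant.
-- _/ℕ_ is floor division (Euclidean, non-negative remainder).
floorPlus : ℕ → ℤ → ℤ → ℤ
floorPlus D t (+ zero)  = 0ℤ
floorPlus D t (+ suc n) = (t + + isqrt D) /ℕ suc n
floorPlus D t -[1+ n ]  = (- t - + isqrt D - 1ℤ) /ℕ suc n

kL : ℕ → Form → ℤ
kL D q = floorPlus D (- b q) (+ 2 * a q)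

-- k in M_R(q) = R^k :  k = ⌊ -(b + √D) / (2c) ⌋ = ⌊ (b + √D) / (-2c) ⌋
kR : ℕ → Form → ℤ
kR D q = floorPlus D (b q) (- (+ 2 * c q))

stepL : ℕ → Form → Form
stepL D q = q ∣∣ Lpow (kL D q)

stepR : ℕ → Form → Form
stepR D q = q ∣∣ Rpow (kR D q)

mutual
  seqL : ℕ → Form → ℕ → Form
  seqL D q zero    = q
  seqL D q (suc n) = seqR D (stepL D q) n

  seqR : ℕ → Form → ℕ → Form
  seqR D q zero    = q
  seqR D q (suc n) = seqL D (stepR D q) n

reductionSeq : ℕ → Form → ℕ → Form
reductionSeq = seqL

EventuallyPeriodic : (ℕ → Form) → Set
EventuallyPeriodic s = ∃[ N ] ∃[ p ] (0 ℕ.< p × (∀ n → N ℕ.≤ n → s (p ℕ.+ n) ≡ s n))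

-- f lies in the cycle (periodic part) of the sequence s:
-- f occurs in s infinitely often
InCycle : (ℕ → Form) → Form → Set
InCycle s f = ∀ N → ∃[ n ] (N ℕ.≤ n × s n ≡ f)

SimplyReduced : Form → Set
SimplyReduced q = (0ℤ ℤ.< a q) × (c q ℤ.< 0ℤ) × (∣ a q + c q ∣ ℕ.< ∣ b q ∣)

-- Let ω = (√D - b) / 2a be the root of q (x , 1) attached to √D and s = ⌊√D⌋; since √D is
-- irrational, every comparison of ω with an integer is a linear condition on s, and all sign
-- arguments reduce to polynomial identities. The step L^k with k = ⌊ω⌋ moves the root into
-- (0 , 1), and the following R-step, the mirror image of an L-step under τ q (x , y) = - q (y , x),
-- moves it above 1. Along these steps |b| decreases until a > 0 > c; this condition persists
-- and makes every later form simply reduced. There are finitely many such forms of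
-- discriminant D, so the sequence is eventually periodic.
--
-- Two equivalent forms with a > 0 > c are related by a matrix of SL₂(ℤ) which, up to sign and
-- inversion, has nonnegative entries, hence is a word in L and R. Each letter preserves
-- a > 0 > c and moves along the cycle, so equivalent forms have the same cycle; conversely a
-- common element of the cycles is equivalent to both forms.

module Submission where

open import Data.Nat as ℕ using (ℕ; zero; suc; z≤n; s≤s; _∸_)
import Data.Nat.Properties as ℕP
open import Data.Nat.GeneralisedArithmetic using (iterate; iterate-is-fold)
import Data.Fin as Fin
import Data.Fin.Properties as FinP
open import Data.List using (List; length; lookup; applyUpTo; _++_; cartesianProduct; cartesianProductWith)
open import Data.List.Membership.Propositional using (_∈_)
open import Data.List.Membership.Propositional.Properties
  using (∈-++⁺ˡ; ∈-++⁺ʳ; ∈-applyUpTo⁺; ∈-cartesianProduct⁺; ∈-cartesianProductWith⁺)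
import Data.List.Relation.Unary.Any as Any
open import Data.List.Relation.Unary.Any.Properties using (lookup-index)
open import Data.Integer as ℤ
  using (ℤ; +_; -[1+_]; 0ℤ; 1ℤ; _+_; _-_; _*_; -_; ∣_∣; _≤_; _<_; +≤+; +<+; _/ℕ_)
import Data.Integer.Properties as ℤP
import Data.Integer.DivMod as ℤDM
open import Data.Integer.Tactic.RingSolver using (solve-∀)
import Data.Nat.Tactic.RingSolver as NatSolver
open import Data.Empty using (⊥; ⊥-elim)
open import Data.Product as Product using (∃-syntax; _×_; _,_; proj₁; proj₂)
open import Data.Sum as Sum using (_⊎_; inj₁; inj₂; [_,_]′)
open import Function using (_∘_; id; _⇔_; mk⇔; Equivalence)
open import Relation.Binary.Definitions using (tri<; tri≈; tri>)
open import Relation.Binary.PropositionalEquality hiding ([_])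
open import Relation.Nullary using (¬_; yes; no)
open import Relation.Binary.Construct.Closure.ReflexiveTransitive using (Star; ε; _◅_)
open import Defs

record NonNeg (x : ℤ) : Set where
  constructor nonneg
  field nonNeg : 0ℤ ≤ x
open NonNeg

-- Positivity is NonNeg (x - 1): every sign argument below exhibits a sum of products of
-- NonNeg quantities and identifies it with the target by a ring identity.
record Pos (x : ℤ) : Set where
  constructor pos
  field nonneg-pred : NonNeg (x - 1ℤ)
open Pos

nonneg-ℕ : ∀ n → NonNeg (+ n)
nonneg-ℕ n = nonneg (+≤+ z≤n)

nonneg-+ : ∀ {x y} → NonNeg x → NonNeg y → NonNeg (x + y)
nonneg-+ (nonneg p) (nonneg q) = nonneg (ℤP.+-mono-≤ p q)

nonneg-* : ∀ {x y} → NonNeg x → NonNeg y → NonNeg (x * y)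
nonneg-* {+ m} {+ n} _ _ = subst NonNeg (ℤP.pos-* m n) (nonneg-ℕ (m ℕ.* n))
nonneg-* {+ m} { -[1+ n ]} _ (nonneg ())
nonneg-* { -[1+ m ]} (nonneg ()) _

square≡abs² : ∀ u → u * u ≡ + (∣ u ∣ ℕ.* ∣ u ∣)
square≡abs² (+ n) = sym (ℤP.pos-* n n)
square≡abs² -[1+ n ] = refl

nonneg-square : ∀ x → NonNeg (x * x)
nonneg-square x = subst NonNeg (sym (square≡abs² x)) (nonneg-ℕ _)

≤⇒nonneg : ∀ {x y} → x ≤ y → NonNeg (y - x)
≤⇒nonneg p = nonneg (ℤP.i≤j⇒0≤j-i p)

nonneg⇒≤ : ∀ {x y} → NonNeg (y - x) → x ≤ y
nonneg⇒≤ (nonneg p) = ℤP.0≤i-j⇒j≤i p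

<⇒pos : ∀ {x y} → x < y → Pos (y - x)
<⇒pos {x} {y} p = pos (subst NonNeg (e x y) (≤⇒nonneg (ℤP.i<j⇒suc[i]≤j p)))
  where e : ∀ x y → y - (1ℤ + x) ≡ y - x - 1ℤ
        e = solve-∀

pos⇒< : ∀ {x y} → Pos (y - x) → x < y
pos⇒< {x} {y} (pos p) = ℤP.suc[i]≤j⇒i<j (nonneg⇒≤ (subst NonNeg (e x y) p))
  where e : ∀ x y → y - x - 1ℤ ≡ y - (1ℤ + x)
        e = solve-∀

0<⇒pos : ∀ {x} → 0ℤ < x → Pos x
0<⇒pos {x} p = subst Pos (ℤP.+-identityʳ x) (<⇒pos p)

pos⇒0< : ∀ {x} → Pos x → 0ℤ < x
pos⇒0< {x} p = pos⇒< (subst Pos (sym (ℤP.+-identityʳ x)) p)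

<0⇒pos-neg : ∀ {x} → x < 0ℤ → Pos (- x)
<0⇒pos-neg {x} p = subst Pos (ℤP.+-identityˡ (- x)) (<⇒pos p)

pos-neg⇒<0 : ∀ {x} → Pos (- x) → x < 0ℤ
pos-neg⇒<0 {x} p = pos⇒< (subst Pos (sym (ℤP.+-identityˡ (- x))) p)

pos⇒nonneg : ∀ {x} → Pos x → NonNeg x
pos⇒nonneg {x} (pos p) = subst NonNeg (e x) (nonneg-+ p (nonneg-ℕ 1))
  where e : ∀ x → x - 1ℤ + + 1 ≡ x
        e = solve-∀

pos-* : ∀ {x y} → Pos x → Pos y → Pos (x * y)
pos-* {x} {y} (pos p) (pos q) = pos (subst NonNeg (e x y) (nonneg-+ (nonneg-+ (nonneg-* p q) p) q))
  where e : ∀ x y → (x - 1ℤ) * (y - 1ℤ) + (x - 1ℤ) + (y - 1ℤ) ≡ x * y - 1ℤ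
        e = solve-∀

pos-ℕ* : ∀ n {x} → Pos x → Pos (+ suc n * x)
pos-ℕ* n = pos-* {+ suc n} (pos (nonneg-ℕ n))

nonneg-≢-neg : ∀ {z} n → NonNeg z → z ≢ - + suc n
nonneg-≢-neg n (nonneg p) refl with p
... | ()

nonneg-pos-neg-⊥ : ∀ {x} → NonNeg x → Pos (- x) → ⊥
nonneg-pos-neg-⊥ {x} p (pos q) = nonneg-≢-neg 0 (nonneg-+ p q) (e x)
  where e : ∀ x → x + (- x - 1ℤ) ≡ - + 1
        e = solve-∀

pos-+-≢0 : ∀ {x y} → Pos x → Pos y → x + y ≢ 0ℤ
pos-+-≢0 {x} {y} p q x+y≡0 = nonneg-pos-neg-⊥ (pos⇒nonneg p) (subst Pos y≡-x q)
  where
  e : ∀ x y → y ≡ x + y - x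
  e = solve-∀
  y≡-x : y ≡ - x
  y≡-x = trans (e x y) (trans (cong (_- x) x+y≡0) (ℤP.+-identityˡ (- x)))

nonneg⊎pos-neg : ∀ z → NonNeg z ⊎ Pos (- z)
nonneg⊎pos-neg (+ n) = inj₁ (nonneg-ℕ n)
nonneg⊎pos-neg -[1+ n ] = inj₂ (pos (nonneg-ℕ n))

≢0⇒pos⊎pos-neg : ∀ x → x ≢ 0ℤ → Pos x ⊎ Pos (- x)
≢0⇒pos⊎pos-neg x x≢0 with ℤP.<-cmp x 0ℤ
... | tri< x<0 _ _ = inj₂ (<0⇒pos-neg x<0)
... | tri≈ _ x≡0 _ = ⊥-elim (x≢0 x≡0)
... | tri> _ _ x>0 = inj₁ (0<⇒pos x>0)

pos-cancelʳ : ∀ {m y} → Pos m → Pos (y * m) → Pos y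
pos-cancelʳ {m} {+ suc n} _ _ = pos (nonneg-ℕ n)
pos-cancelʳ {m} {+ zero} _ (pos p) = ⊥-elim (nonneg-pos-neg-⊥ (nonneg-ℕ 0) (pos p))
pos-cancelʳ {m} { -[1+ n ]} pm p =
  ⊥-elim (nonneg-pos-neg-⊥ (pos⇒nonneg p)
    (subst Pos (sym (ℤP.neg-distribˡ-* -[1+ n ] m)) (pos-* {+ suc n} (pos (nonneg-ℕ n)) pm)))

nonneg-half : ∀ y → NonNeg (y + y) → NonNeg y
nonneg-half (+ n) _ = nonneg-ℕ n
nonneg-half -[1+ n ] (nonneg ())

∣y∣<∣x∣-from-pos : ∀ x y → Pos (x - y) → Pos (x + y) → ∣ y ∣ ℕ.< ∣ x ∣
∣y∣<∣x∣-from-pos x y p q =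
  ℤP.drop‿+<+ (pos⇒< (subst (λ u → Pos (u - + ∣ y ∣)) (sym ∣x∣≡x) (x-∣y∣-pos (ℤP.+∣i∣≡i⊎+∣i∣≡-i y))))
  where
  x-pos : Pos x
  x-pos = pos (nonneg-half (x - 1ℤ) (subst NonNeg (e x y) (nonneg-+ (nonneg-pred p) (nonneg-pred q))))
    where e : ∀ x y → x - y - 1ℤ + (x + y - 1ℤ) ≡ x - 1ℤ + (x - 1ℤ)
          e = solve-∀
  ∣x∣≡x : + ∣ x ∣ ≡ x
  ∣x∣≡x = ℤP.0≤i⇒+∣i∣≡i (nonNeg (pos⇒nonneg x-pos))
  x-∣y∣-pos : + ∣ y ∣ ≡ y ⊎ + ∣ y ∣ ≡ - y → Pos (x - + ∣ y ∣)
  x-∣y∣-pos (inj₁ e) = subst (λ u → Pos (x - u)) (sym e) p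
  x-∣y∣-pos (inj₂ e) = subst (λ u → Pos (x - u)) (sym e) (subst Pos (cong (_+_ x) (sym (ℤP.neg-involutive y))) q)

isqrt-bounds : ∀ n → isqrt n ℕ.* isqrt n ℕ.≤ n × n ℕ.< suc (isqrt n) ℕ.* suc (isqrt n)
isqrt-bounds zero = z≤n , s≤s z≤n
isqrt-bounds (suc n) with isqrt n | isqrt-bounds n
... | r | (r²≤n , n<[r+1]²) with suc r ℕ.* suc r ℕ.≤? suc n
...   | yes p = p , ℕP.≤-<-trans n<[r+1]² (ℕP.*-mono-< (ℕP.n<1+n (suc r)) (ℕP.n<1+n (suc r)))
...   | no ¬p = ℕP.m≤n⇒m≤1+n r²≤n , ℕP.≰⇒> ¬p

IsFloor : ℤ → ℤ → ℤ → Set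
IsFloor T m k = NonNeg (T - k * m) × Pos ((k + 1ℤ) * m - T)

/ℕ-isFloor : ∀ T n → IsFloor T (+ suc n) (T /ℕ suc n)
/ℕ-isFloor T n =
  ≤⇒nonneg (ℤDM.[n/ℕd]*d≤n T (suc n)) ,
  subst Pos (e T (T /ℕ suc n) (+ suc n)) (<⇒pos (ℤDM.n<s[n/ℕd]*d T (suc n)))
  where e : ∀ T k m → (1ℤ + k) * m - T ≡ (k + 1ℤ) * m - T
        e = solve-∀

isFloor-≤ : ∀ {T m k k′} → Pos m → NonNeg (T - k * m) → Pos ((k′ + 1ℤ) * m - T) → k ≤ k′
isFloor-≤ {T} {m} {k} {k′} m>0 p q =
  nonneg⇒≤ (subst NonNeg (e′ k k′) (nonneg-pred (pos-cancelʳ {y = k′ + 1ℤ - k} m>0 (pos (subst NonNeg (e T m k k′) (nonneg-+ p (nonneg-pred q)))))))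
  where e : ∀ T m k k′ → T - k * m + ((k′ + 1ℤ) * m - T - 1ℤ) ≡ (k′ + 1ℤ - k) * m - 1ℤ
        e = solve-∀
        e′ : ∀ k k′ → k′ + 1ℤ - k - 1ℤ ≡ k′ - k
        e′ = solve-∀

isFloor-unique : ∀ {T m k k′} → Pos m → IsFloor T m k → IsFloor T m k′ → k ≡ k′
isFloor-unique m>0 (p , q) (p′ , q′) = ℤP.≤-antisym (isFloor-≤ m>0 p q′) (isFloor-≤ m>0 p′ q)

form-≡ : ∀ {a₁ b₁ c₁ a₂ b₂ c₂} → a₁ ≡ a₂ → b₁ ≡ b₂ → c₁ ≡ c₂ → [ a₁ , b₁ , c₁ ] ≡ [ a₂ , b₂ , c₂ ]
form-≡ refl refl refl = refl

mat-≡ : ∀ {α₁ β₁ γ₁ δ₁ α₂ β₂ γ₂ δ₂} →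
  α₁ ≡ α₂ → β₁ ≡ β₂ → γ₁ ≡ γ₂ → δ₁ ≡ δ₂ → mat α₁ β₁ γ₁ δ₁ ≡ mat α₂ β₂ γ₂ δ₂
mat-≡ refl refl refl refl = refl

_⊗_ : Mat → Mat → Mat
mat α β γ δ ⊗ mat α′ β′ γ′ δ′ = mat (α * α′ + β * γ′) (α * β′ + β * δ′) (γ * α′ + δ * γ′) (γ * β′ + δ * δ′)

I₂ : Mat
I₂ = mat 1ℤ 0ℤ 0ℤ 1ℤ

adj : Mat → Mat
adj (mat α β γ δ) = mat δ (- β) (- γ) α

∣∣-⊗ : ∀ q A B → (q ∣∣ A) ∣∣ B ≡ q ∣∣ (A ⊗ B)
∣∣-⊗ [ a , b , c ] (mat α β γ δ) (mat α′ β′ γ′ δ′) =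
  form-≡ (e₁ a b c α β γ δ α′ β′ γ′ δ′) (e₂ a b c α β γ δ α′ β′ γ′ δ′) (e₃ a b c α β γ δ α′ β′ γ′ δ′)
  where
  e₁ : ∀ a b c α β γ δ α′ β′ γ′ δ′ →
    (a * α * α + b * α * γ + c * γ * γ) * α′ * α′ + (+ 2 * a * α * β + b * (α * δ + β * γ) + + 2 * c * γ * δ) * α′ * γ′
      + (a * β * β + b * β * δ + c * δ * δ) * γ′ * γ′
    ≡ a * (α * α′ + β * γ′) * (α * α′ + β * γ′) + b * (α * α′ + β * γ′) * (γ * α′ + δ * γ′) + c * (γ * α′ + δ * γ′) * (γ * α′ + δ * γ′)
  e₁ = solve-∀
  e₂ : ∀ a b c α β γ δ α′ β′ γ′ δ′ →
    + 2 * (a * α * α + b * α * γ + c * γ * γ) * α′ * β′ + (+ 2 * a * α * β + b * (α * δ + β * γ) + + 2 * c * γ * δ) * (α′ * δ′ + β′ * γ′)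
      + + 2 * (a * β * β + b * β * δ + c * δ * δ) * γ′ * δ′
    ≡ + 2 * a * (α * α′ + β * γ′) * (α * β′ + β * δ′) + b * ((α * α′ + β * γ′) * (γ * β′ + δ * δ′) + (α * β′ + β * δ′) * (γ * α′ + δ * γ′))
      + + 2 * c * (γ * α′ + δ * γ′) * (γ * β′ + δ * δ′)
  e₂ = solve-∀
  e₃ : ∀ a b c α β γ δ α′ β′ γ′ δ′ →
    (a * α * α + b * α * γ + c * γ * γ) * β′ * β′ + (+ 2 * a * α * β + b * (α * δ + β * γ) + + 2 * c * γ * δ) * β′ * δ′ + (a * β * β + b * β * δ + c * δ * δ) * δ′ * δ′
    ≡ a * (α * β′ + β * δ′) * (α * β′ + β * δ′) + b * (α * β′ + β * δ′) * (γ * β′ + δ * δ′) + c * (γ * β′ + δ * δ′) * (γ * β′ + δ * δ′)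
  e₃ = solve-∀

∣∣-I₂ : ∀ q → q ∣∣ I₂ ≡ q
∣∣-I₂ [ a , b , c ] = form-≡ (e₁ a b c) (e₂ a b c) (e₃ a b c)
  where
  e₁ : ∀ a b c → a * 1ℤ * 1ℤ + b * 1ℤ * 0ℤ + c * 0ℤ * 0ℤ ≡ a
  e₁ = solve-∀
  e₂ : ∀ a b c → + 2 * a * 1ℤ * 0ℤ + b * (1ℤ * 1ℤ + 0ℤ * 0ℤ) + + 2 * c * 0ℤ * 1ℤ ≡ b
  e₂ = solve-∀
  e₃ : ∀ a b c → a * 0ℤ * 0ℤ + b * 0ℤ * 1ℤ + c * 1ℤ * 1ℤ ≡ c
  e₃ = solve-∀

∣∣-neg : ∀ q α β γ δ → q ∣∣ mat (- α) (- β) (- γ) (- δ) ≡ q ∣∣ mat α β γ δ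
∣∣-neg [ a , b , c ] α β γ δ = form-≡ (e₁ a b c α β γ δ) (e₂ a b c α β γ δ) (e₃ a b c α β γ δ)
  where
  e₁ : ∀ a b c α β γ δ → a * (- α) * (- α) + b * (- α) * (- γ) + c * (- γ) * (- γ) ≡ a * α * α + b * α * γ + c * γ * γ
  e₁ = solve-∀
  e₂ : ∀ a b c α β γ δ → + 2 * a * (- α) * (- β) + b * ((- α) * (- δ) + (- β) * (- γ)) + + 2 * c * (- γ) * (- δ)
                        ≡ + 2 * a * α * β + b * (α * δ + β * γ) + + 2 * c * γ * δ
  e₂ = solve-∀
  e₃ : ∀ a b c α β γ δ → a * (- β) * (- β) + b * (- β) * (- δ) + c * (- δ) * (- δ) ≡ a * β * β + b * β * δ + c * δ * δ
  e₃ = solve-∀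

det-⊗ : ∀ A B → det (A ⊗ B) ≡ det A * det B
det-⊗ (mat α β γ δ) (mat α′ β′ γ′ δ′) = e α β γ δ α′ β′ γ′ δ′
  where e : ∀ α β γ δ α′ β′ γ′ δ′ →
          (α * α′ + β * γ′) * (γ * β′ + δ * δ′) - (α * β′ + β * δ′) * (γ * α′ + δ * γ′) ≡ (α * δ - β * γ) * (α′ * δ′ - β′ * γ′)
        e = solve-∀

det-adj : ∀ M → det (adj M) ≡ det M
det-adj (mat α β γ δ) = e α β γ δ
  where e : ∀ α β γ δ → δ * α - (- β) * (- γ) ≡ α * δ - β * γ
        e = solve-∀

⊗-adj : ∀ M → det M ≡ 1ℤ → M ⊗ adj M ≡ I₂
⊗-adj (mat α β γ δ) d = mat-≡ (trans (e₁ α β γ δ) d) (e₂ α β γ δ) (e₃ α β γ δ) (trans (e₄ α β γ δ) d)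
  where e₁ : ∀ α β γ δ → α * δ + β * (- γ) ≡ α * δ - β * γ
        e₁ = solve-∀
        e₂ : ∀ α β γ δ → α * (- β) + β * α ≡ 0ℤ
        e₂ = solve-∀
        e₃ : ∀ α β γ δ → γ * δ + δ * (- γ) ≡ 0ℤ
        e₃ = solve-∀
        e₄ : ∀ α β γ δ → γ * (- β) + δ * α ≡ α * δ - β * γ
        e₄ = solve-∀

disc-∣∣ : ∀ q M → disc (q ∣∣ M) ≡ det M * det M * disc q
disc-∣∣ [ a , b , c ] (mat α β γ δ) = e a b c α β γ δ
  where e : ∀ a b c α β γ δ →
          (+ 2 * a * α * β + b * (α * δ + β * γ) + + 2 * c * γ * δ) * (+ 2 * a * α * β + b * (α * δ + β * γ) + + 2 * c * γ * δ)
          - + 4 * (a * α * α + b * α * γ + c * γ * γ) * (a * β * β + b * β * δ + c * δ * δ)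
          ≡ (α * δ - β * γ) * (α * δ - β * γ) * (b * b - + 4 * a * c)
        e = solve-∀

disc-∣∣-SL₂ : ∀ q M → det M ≡ 1ℤ → disc (q ∣∣ M) ≡ disc q
disc-∣∣-SL₂ q M d = trans (disc-∣∣ q M) (trans (cong (λ t → t * t * disc q) d) (ℤP.*-identityˡ (disc q)))

∼-refl : ∀ {q} → q ∼ q
∼-refl {q} = I₂ , refl , sym (∣∣-I₂ q)

∼-trans : ∀ {x y z} → x ∼ y → y ∼ z → x ∼ z
∼-trans {z = z} (M , det-M , x≡yM) (N , det-N , y≡zN) =
  N ⊗ M , trans (det-⊗ N M) (cong₂ _*_ det-N det-M) , trans x≡yM (trans (cong (_∣∣ M) y≡zN) (∣∣-⊗ z N M))

∼-sym : ∀ {x y} → x ∼ y → y ∼ x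
∼-sym {y = y} (M , det-M , x≡yM) =
  adj M , trans (det-adj M) det-M ,
  sym (trans (cong (_∣∣ adj M) x≡yM) (trans (∣∣-⊗ y M (adj M)) (trans (cong (y ∣∣_) (⊗-adj M det-M)) (∣∣-I₂ y))))

det-Lpow : ∀ k → det (Lpow k) ≡ 1ℤ
det-Lpow k = e k
  where e : ∀ k → 1ℤ * 1ℤ - k * 0ℤ ≡ 1ℤ
        e = solve-∀

det-Rpow : ∀ k → det (Rpow k) ≡ 1ℤ
det-Rpow k = e k
  where e : ∀ k → 1ℤ * 1ℤ - 0ℤ * k ≡ 1ℤ
        e = solve-∀

∣∣-Lpow : ∀ a b c k → [ a , b , c ] ∣∣ Lpow k ≡ [ a , + 2 * a * k + b , a * k * k + b * k + c ]
∣∣-Lpow a b c k = form-≡ (e₁ a b c k) (e₂ a b c k) (e₃ a b c k)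
  where e₁ : ∀ a b c k → a * 1ℤ * 1ℤ + b * 1ℤ * 0ℤ + c * 0ℤ * 0ℤ ≡ a
        e₁ = solve-∀
        e₂ : ∀ a b c k → + 2 * a * 1ℤ * k + b * (1ℤ * 1ℤ + k * 0ℤ) + + 2 * c * 0ℤ * 1ℤ ≡ + 2 * a * k + b
        e₂ = solve-∀
        e₃ : ∀ a b c k → a * k * k + b * k * 1ℤ + c * 1ℤ * 1ℤ ≡ a * k * k + b * k + c
        e₃ = solve-∀

∣∣-Rpow : ∀ a b c k → [ a , b , c ] ∣∣ Rpow k ≡ [ a + b * k + c * k * k , b + + 2 * c * k , c ]
∣∣-Rpow a b c k = form-≡ (e₁ a b c k) (e₂ a b c k) (e₃ a b c k)
  where e₁ : ∀ a b c k → a * 1ℤ * 1ℤ + b * 1ℤ * k + c * k * k ≡ a + b * k + c * k * k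
        e₁ = solve-∀
        e₂ : ∀ a b c k → + 2 * a * 1ℤ * 0ℤ + b * (1ℤ * 1ℤ + 0ℤ * k) + + 2 * c * k * 1ℤ ≡ b + + 2 * c * k
        e₂ = solve-∀
        e₃ : ∀ a b c k → a * 0ℤ * 0ℤ + b * 0ℤ * 1ℤ + c * 1ℤ * 1ℤ ≡ c
        e₃ = solve-∀

Lpow-⊗ : ∀ j k → Lpow j ⊗ Lpow k ≡ Lpow (j + k)
Lpow-⊗ j k = mat-≡ (e₁ j) (e₂ j k) (e₃ j) (e₄ k)
  where e₁ : ∀ j → 1ℤ * 1ℤ + j * 0ℤ ≡ 1ℤ
        e₁ = solve-∀
        e₂ : ∀ j k → 1ℤ * k + j * 1ℤ ≡ j + k
        e₂ = solve-∀
        e₃ : ∀ j → 0ℤ * 1ℤ + 1ℤ * 0ℤ ≡ 0ℤ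
        e₃ = solve-∀
        e₄ : ∀ k → 0ℤ * k + 1ℤ * 1ℤ ≡ 1ℤ
        e₄ = solve-∀

stepL-∼ : ∀ D q → stepL D q ∼ q
stepL-∼ D q = Lpow (kL D q) , det-Lpow (kL D q) , refl

stepR-∼ : ∀ D q → stepR D q ∼ q
stepR-∼ D q = Rpow (kR D q) , det-Rpow (kR D q) , refl

mutual
  seqL-∼ : ∀ D q n → seqL D q n ∼ q
  seqL-∼ D q zero = ∼-refl
  seqL-∼ D q (suc n) = ∼-trans {seqR D (stepL D q) n} {stepL D q} {q} (seqR-∼ D (stepL D q) n) (stepL-∼ D q)

  seqR-∼ : ∀ D q n → seqR D q n ∼ q
  seqR-∼ D q zero = ∼-refl
  seqR-∼ D q (suc n) = ∼-trans {seqL D (stepR D q) n} {stepR D q} {q} (seqL-∼ D (stepR D q) n) (stepR-∼ D q)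

isqrt-≤ : ∀ n → isqrt n ℕ.≤ n
isqrt-≤ n = r≤r²≤n (isqrt n) (proj₁ (isqrt-bounds n))
  where r≤r²≤n : ∀ r → r ℕ.* r ℕ.≤ n → r ℕ.≤ n
        r≤r²≤n zero _ = z≤n
        r≤r²≤n (suc r) r²≤n = ℕP.≤-trans (ℕP.m≤m*n (suc r) (suc r)) r²≤n

∣x∣≤n : ∀ x n → NonNeg (+ n - x) → NonNeg (+ n + x) → ∣ x ∣ ℕ.≤ n
∣x∣≤n (+ m) n p _ = ℤP.drop‿+≤+ (nonneg⇒≤ p)
∣x∣≤n -[1+ m ] n _ q = ℤP.drop‿+≤+ (nonneg⇒≤ {x = + suc m} {y = + n} q)

iterate-+ : ∀ {A : Set} (f : A → A) x m n → iterate f x (m ℕ.+ n) ≡ iterate f (iterate f x m) n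
iterate-+ f x zero n = refl
iterate-+ f x (suc m) n = iterate-+ f (f x) m n

iterate-suc : ∀ {A : Set} (f : A → A) x n → iterate f x (suc n) ≡ f (iterate f x n)
iterate-suc f x n = trans (sym (iterate-is-fold x f (suc n))) (cong f (iterate-is-fold x f n))

pigeonhole : ∀ {A : Set} (xs : List A) (f : ℕ → A) → (∀ i → f i ∈ xs) → ∃[ i ] ∃[ j ] (i ℕ.< j × f i ≡ f j)
pigeonhole xs f f∈xs with FinP.pigeonhole (ℕP.n<1+n (length xs)) (λ i → Any.index (f∈xs (Fin.toℕ i)))
... | i , j , i<j , same-index =
  Fin.toℕ i , Fin.toℕ j , i<j ,
  trans (lookup-index (f∈xs (Fin.toℕ i))) (trans (cong (lookup xs) same-index) (sym (lookup-index (f∈xs (Fin.toℕ j)))))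

intsWithin : ℕ → List ℤ
intsWithin n = applyUpTo +_ (suc n) ++ applyUpTo -[1+_] n

∈-intsWithin : ∀ {x n} → ∣ x ∣ ℕ.≤ n → x ∈ intsWithin n
∈-intsWithin {+ m} m≤n = ∈-++⁺ˡ (∈-applyUpTo⁺ +_ (s≤s m≤n))
∈-intsWithin { -[1+ m ]} {n} m<n = ∈-++⁺ʳ (applyUpTo +_ (suc n)) (∈-applyUpTo⁺ -[1+_] m<n)

formsWithin : ℕ → List Form
formsWithin n =
  cartesianProductWith (λ x yz → [ x , proj₁ yz , proj₂ yz ]) (intsWithin n) (cartesianProduct (intsWithin n) (intsWithin n))

∈-formsWithin : ∀ {n} q → ∣ a q ∣ ℕ.≤ n → ∣ b q ∣ ℕ.≤ n → ∣ c q ∣ ℕ.≤ n → q ∈ formsWithin n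
∈-formsWithin q ∣a∣≤n ∣b∣≤n ∣c∣≤n =
  ∈-cartesianProductWith⁺ _ (∈-intsWithin ∣a∣≤n) (∈-cartesianProduct⁺ (∈-intsWithin ∣b∣≤n) (∈-intsWithin ∣c∣≤n))

SameCycle : (ℕ → Form) → (ℕ → Form) → Set
SameCycle s t = ∀ f → InCycle s f ⇔ InCycle t f

SameCycle-refl : ∀ {s} → SameCycle s s
SameCycle-refl f = mk⇔ id id

SameCycle-sym : ∀ {s t} → SameCycle s t → SameCycle t s
SameCycle-sym s~t f = mk⇔ (Equivalence.from (s~t f)) (Equivalence.to (s~t f))

SameCycle-trans : ∀ {s t u} → SameCycle s t → SameCycle t u → SameCycle s u
SameCycle-trans s~t t~u f = mk⇔ (Equivalence.to (t~u f) ∘ Equivalence.to (s~t f)) (Equivalence.from (s~t f) ∘ Equivalence.from (t~u f))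

SameCycle-pointwise : ∀ {s t} → (∀ n → s n ≡ t n) → SameCycle s t
SameCycle-pointwise {s} {t} s≗t f = mk⇔ (λ h N → transport (sym ∘ s≗t) (h N)) (λ h N → transport s≗t (h N))
  where
  transport : ∀ {u v : ℕ → Form} {N} → (∀ n → v n ≡ u n) → ∃[ n ] (N ℕ.≤ n × u n ≡ f) → ∃[ n ] (N ℕ.≤ n × v n ≡ f)
  transport v≗u (n , N≤n , un≡f) = n , N≤n , trans (v≗u n) un≡f

SameCycle-shift : ∀ s m → SameCycle s (λ n → s (m ℕ.+ n))
SameCycle-shift s m f = mk⇔ to from
  where
  to : InCycle s f → InCycle (λ n → s (m ℕ.+ n)) f
  to h N with h (m ℕ.+ N)
  ... | n , m+N≤n , sn≡f =
    n ∸ m , ℕP.+-cancelˡ-≤ m N (n ∸ m) (subst (m ℕ.+ N ℕ.≤_) (sym (ℕP.m+[n∸m]≡n m≤n)) m+N≤n) ,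
    trans (cong s (ℕP.m+[n∸m]≡n m≤n)) sn≡f
    where m≤n = ℕP.≤-trans (ℕP.m≤m+n m N) m+N≤n
  from : InCycle (λ n → s (m ℕ.+ n)) f → InCycle s f
  from h N with h N
  ... | n , N≤n , e = m ℕ.+ n , ℕP.≤-trans N≤n (ℕP.m≤n+m n m) , e

periodic⇒InCycle : ∀ s N p → 0 ℕ.< p → (∀ n → N ℕ.≤ n → s (p ℕ.+ n) ≡ s n) → InCycle s (s N)
periodic⇒InCycle s N (suc p′) _ per M = M ℕ.* p ℕ.+ N , ℕP.≤-trans (ℕP.m≤m*n M p) (ℕP.m≤m+n (M ℕ.* p) N) , repeat M
  where
  p = suc p′
  repeat : ∀ k → s (k ℕ.* p ℕ.+ N) ≡ s N
  repeat zero = refl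
  repeat (suc k) = trans (cong s (ℕP.+-assoc p (k ℕ.* p) N)) (trans (per _ (ℕP.m≤n+m N (k ℕ.* p))) (repeat k))

-- Opaque, since otherwise conversion checking unfolds stepR D (stepL D q) into enormous terms.
opaque
  stepRL : ℕ → Form → Form
  stepRL D q = stepR D (stepL D q)

  stepRL-unfold : ∀ D q → stepRL D q ≡ stepR D (stepL D q)
  stepRL-unfold D q = refl

seqL-iterate : ∀ D k q n → seqL D q (k ℕ.* 2 ℕ.+ n) ≡ seqL D (iterate (stepRL D) q k) n
seqL-iterate D zero q n = refl
seqL-iterate D (suc k) q n = trans (cong (λ x → seqL D x (k ℕ.* 2 ℕ.+ n)) (sym (stepRL-unfold D q))) (seqL-iterate D k (stepRL D q) n)

seqL-after : ∀ D k q n → k ℕ.* 2 ℕ.≤ n → seqL D q n ≡ seqL D (iterate (stepRL D) q k) (n ∸ k ℕ.* 2)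
seqL-after D k q n le = trans (cong (seqL D q) (sym (ℕP.m+[n∸m]≡n le))) (seqL-iterate D k q (n ∸ k ℕ.* 2))

iterate-stepRL-∼ : ∀ D q k → iterate (stepRL D) q k ∼ q
iterate-stepRL-∼ D q k = subst (_∼ q) (seqL-iterate D k q 0) (seqL-∼ D q (k ℕ.* 2 ℕ.+ 0))

InCycle-seqL⇒∼ : ∀ D q f → InCycle (seqL D q) f → f ∼ q
InCycle-seqL⇒∼ D q f f∈cycle = let (n , _ , qₙ≡f) = f∈cycle 0 in subst (_∼ q) qₙ≡f (seqL-∼ D q n)

SameCycle-iterate : ∀ D q k → SameCycle (seqL D q) (seqL D (iterate (stepRL D) q k))
SameCycle-iterate D q k = SameCycle-trans (SameCycle-shift (seqL D q) (k ℕ.* 2)) (SameCycle-pointwise (seqL-iterate D k q))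

periodic-iterate⇒periodic-seqL : ∀ D q N p → iterate (stepRL D) q (p ℕ.+ N) ≡ iterate (stepRL D) q N →
  ∀ n → N ℕ.* 2 ℕ.≤ n → seqL D q (p ℕ.* 2 ℕ.+ n) ≡ seqL D q n
periodic-iterate⇒periodic-seqL D q N p per n le = begin
  seqL D q (p ℕ.* 2 ℕ.+ n)                                 ≡⟨ cong (λ m → seqL D q (p ℕ.* 2 ℕ.+ m)) (sym (ℕP.m+[n∸m]≡n le)) ⟩
  seqL D q (p ℕ.* 2 ℕ.+ (N ℕ.* 2 ℕ.+ r))                    ≡⟨ cong (seqL D q) (sym index) ⟩
  seqL D q ((p ℕ.+ N) ℕ.* 2 ℕ.+ r)                          ≡⟨ seqL-iterate D (p ℕ.+ N) q r ⟩
  seqL D (iterate (stepRL D) q (p ℕ.+ N)) r                 ≡⟨ cong (λ x → seqL D x r) per ⟩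
  seqL D (iterate (stepRL D) q N) r                         ≡⟨ sym (seqL-after D N q n le) ⟩
  seqL D q n                                                ∎
  where
  open ≡-Reasoning
  r = n ∸ N ℕ.* 2
  index : (p ℕ.+ N) ℕ.* 2 ℕ.+ r ≡ p ℕ.* 2 ℕ.+ (N ℕ.* 2 ℕ.+ r)
  index = trans (cong (ℕ._+ r) (ℕP.*-distribʳ-+ 2 p N)) (ℕP.+-assoc (p ℕ.* 2) (N ℕ.* 2) r)

negForm : Form → Form
negForm q = [ - a q , - b q , - c q ]

negForm-∣∣ : ∀ q M → negForm (q ∣∣ M) ≡ negForm q ∣∣ M
negForm-∣∣ [ a , b , c ] (mat α β γ δ) = form-≡ (e₁ a b c α γ) (e₂ a b c α β γ δ) (e₃ a b c β δ)
  where
  e₁ : ∀ a b c α γ → - (a * α * α + b * α * γ + c * γ * γ) ≡ (- a) * α * α + (- b) * α * γ + (- c) * γ * γ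
  e₁ = solve-∀
  e₂ : ∀ a b c α β γ δ → - (+ 2 * a * α * β + b * (α * δ + β * γ) + + 2 * c * γ * δ) ≡ + 2 * (- a) * α * β + (- b) * (α * δ + β * γ) + + 2 * (- c) * γ * δ
  e₂ = solve-∀
  e₃ : ∀ a b c β δ → - (a * β * β + b * β * δ + c * δ * δ) ≡ (- a) * β * β + (- b) * β * δ + (- c) * δ * δ
  e₃ = solve-∀

disc-negForm : ∀ q → disc (negForm q) ≡ disc q
disc-negForm q = e (a q) (b q) (c q)
  where e : ∀ a b c → (- b) * (- b) - + 4 * (- a) * (- c) ≡ b * b - + 4 * a * c
        e = solve-∀

data LRWord : Mat → Set where
  [] : LRWord I₂
  L∷_ : ∀ {M} → LRWord M → LRWord (Lpow 1ℤ ⊗ M)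
  R∷_ : ∀ {M} → LRWord M → LRWord (Rpow 1ℤ ⊗ M)

det-LRWord : ∀ {M} → LRWord M → det M ≡ 1ℤ
det-LRWord [] = refl
det-LRWord (L∷_ {M} w) = trans (det-⊗ (Lpow 1ℤ) M) (cong₂ _*_ (det-Lpow 1ℤ) (det-LRWord w))
det-LRWord (R∷_ {M} w) = trans (det-⊗ (Rpow 1ℤ) M) (cong₂ _*_ (det-Rpow 1ℤ) (det-LRWord w))

matℕ : ℕ → ℕ → ℕ → ℕ → Mat
matℕ α β γ δ = mat (+ α) (+ β) (+ γ) (+ δ)

entrySum : ℕ → ℕ → ℕ → ℕ → ℕ
entrySum α β γ δ = α ℕ.+ β ℕ.+ γ ℕ.+ δ

Det≡1 : ℕ → ℕ → ℕ → ℕ → Set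
Det≡1 α β γ δ = + α * + δ - + β * + γ ≡ 1ℤ

data LRFactor (α β γ δ : ℕ) : Set where
  identity : matℕ α β γ δ ≡ I₂ → LRFactor α β γ δ
  L-factor : ∀ α′ β′ γ′ δ′ → Lpow 1ℤ ⊗ matℕ α′ β′ γ′ δ′ ≡ matℕ α β γ δ → Det≡1 α′ β′ γ′ δ′ →
             entrySum α′ β′ γ′ δ′ ℕ.< entrySum α β γ δ → LRFactor α β γ δ
  R-factor : ∀ α′ β′ γ′ δ′ → Rpow 1ℤ ⊗ matℕ α′ β′ γ′ δ′ ≡ matℕ α β γ δ → Det≡1 α′ β′ γ′ δ′ →
             entrySum α′ β′ γ′ δ′ ℕ.< entrySum α β γ δ → LRFactor α β γ δ

private
  +[m∸n] : ∀ {m n} → n ℕ.≤ m → + (m ∸ n) ≡ + m - + n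
  +[m∸n] {m} {n} n≤m = trans (sym (ℤP.⊖-≥ n≤m)) (sym (ℤP.[+m]-[+n]≡m⊖n m n))

L-factor-of : ∀ {α β γ δ} → γ ℕ.≤ α → δ ℕ.≤ β → Det≡1 α β γ δ → 1 ℕ.≤ γ ℕ.+ δ → LRFactor α β γ δ
L-factor-of {α} {β} {γ} {δ} γ≤α δ≤β det 1≤γ+δ = L-factor (α ∸ γ) (β ∸ δ) γ δ product det′ smaller
  where
  eα = +[m∸n] γ≤α
  eβ = +[m∸n] δ≤β
  product : Lpow 1ℤ ⊗ matℕ (α ∸ γ) (β ∸ δ) γ δ ≡ matℕ α β γ δ
  product = mat-≡ (trans (cong (λ t → 1ℤ * t + 1ℤ * + γ) eα) (e₁ (+ α) (+ γ)))
                  (trans (cong (λ t → 1ℤ * t + 1ℤ * + δ) eβ) (e₁ (+ β) (+ δ)))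
                  (e₂ (+ (α ∸ γ)) (+ γ)) (e₂ (+ (β ∸ δ)) (+ δ))
    where e₁ : ∀ x y → 1ℤ * (x - y) + 1ℤ * y ≡ x
          e₁ = solve-∀
          e₂ : ∀ x y → 0ℤ * x + 1ℤ * y ≡ y
          e₂ = solve-∀
  det′ : Det≡1 (α ∸ γ) (β ∸ δ) γ δ
  det′ = trans (cong₂ (λ u v → u * + δ - v * + γ) eα eβ) (trans (e (+ α) (+ β) (+ γ) (+ δ)) det)
    where e : ∀ x y z w → (x - z) * w - (y - w) * z ≡ x * w - y * z
          e = solve-∀
  smaller : entrySum (α ∸ γ) (β ∸ δ) γ δ ℕ.< entrySum α β γ δ
  smaller = subst₂ ℕ._<_ (sym (regroup (α ∸ γ) (β ∸ δ) γ δ))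
              (cong₂ (λ u v → u ℕ.+ v ℕ.+ γ ℕ.+ δ) (ℕP.m∸n+n≡m γ≤α) (ℕP.m∸n+n≡m δ≤β))
              (ℕP.<-≤-trans (ℕP.m<m+n _ 1≤γ+δ) (ℕP.≤-reflexive (shuffle (α ∸ γ) (β ∸ δ) γ δ)))
    where regroup : ∀ A B g d → A ℕ.+ B ℕ.+ g ℕ.+ d ≡ (A ℕ.+ B) ℕ.+ (g ℕ.+ d)
          regroup = NatSolver.solve-∀
          shuffle : ∀ A B g d → (A ℕ.+ B) ℕ.+ (g ℕ.+ d) ℕ.+ (g ℕ.+ d) ≡ (A ℕ.+ g) ℕ.+ (B ℕ.+ d) ℕ.+ g ℕ.+ d
          shuffle = NatSolver.solve-∀

R-factor-of : ∀ {α β γ δ} → α ℕ.≤ γ → β ℕ.≤ δ → Det≡1 α β γ δ → 1 ℕ.≤ α ℕ.+ β → LRFactor α β γ δ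
R-factor-of {α} {β} {γ} {δ} α≤γ β≤δ det 1≤α+β = R-factor α β (γ ∸ α) (δ ∸ β) product det′ smaller
  where
  eγ = +[m∸n] α≤γ
  eδ = +[m∸n] β≤δ
  product : Rpow 1ℤ ⊗ matℕ α β (γ ∸ α) (δ ∸ β) ≡ matℕ α β γ δ
  product = mat-≡ (e₂ (+ α) (+ (γ ∸ α))) (e₂ (+ β) (+ (δ ∸ β)))
                  (trans (cong (λ t → 1ℤ * + α + 1ℤ * t) eγ) (e₁ (+ γ) (+ α)))
                  (trans (cong (λ t → 1ℤ * + β + 1ℤ * t) eδ) (e₁ (+ δ) (+ β)))
    where e₁ : ∀ x y → 1ℤ * y + 1ℤ * (x - y) ≡ x
          e₁ = solve-∀
          e₂ : ∀ x y → 1ℤ * x + 0ℤ * y ≡ x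
          e₂ = solve-∀
  det′ : Det≡1 α β (γ ∸ α) (δ ∸ β)
  det′ = trans (cong₂ (λ u v → + α * v - + β * u) eγ eδ) (trans (e (+ α) (+ β) (+ γ) (+ δ)) det)
    where e : ∀ x y z w → x * (w - y) - y * (z - x) ≡ x * w - y * z
          e = solve-∀
  smaller : entrySum α β (γ ∸ α) (δ ∸ β) ℕ.< entrySum α β γ δ
  smaller = subst₂ ℕ._<_ (sym (regroup α β (γ ∸ α) (δ ∸ β)))
              (cong₂ (λ u v → α ℕ.+ β ℕ.+ u ℕ.+ v) (ℕP.m∸n+n≡m α≤γ) (ℕP.m∸n+n≡m β≤δ))
              (ℕP.<-≤-trans (ℕP.m<m+n _ 1≤α+β) (ℕP.≤-reflexive (shuffle α β (γ ∸ α) (δ ∸ β))))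
    where regroup : ∀ A B g d → A ℕ.+ B ℕ.+ g ℕ.+ d ≡ (g ℕ.+ d) ℕ.+ (A ℕ.+ B)
          regroup = NatSolver.solve-∀
          shuffle : ∀ A B g d → (g ℕ.+ d) ℕ.+ (A ℕ.+ B) ℕ.+ (A ℕ.+ B) ≡ A ℕ.+ B ℕ.+ (g ℕ.+ A) ℕ.+ (d ℕ.+ B)
          shuffle = NatSolver.solve-∀

γ+δ≥1 : ∀ α β γ δ → Det≡1 α β γ δ → 1 ℕ.≤ γ ℕ.+ δ
γ+δ≥1 α β zero zero det with trans (sym (e (+ α) (+ β))) det
  where e : ∀ x y → x * + 0 - y * + 0 ≡ 0ℤ
        e = solve-∀
... | ()
γ+δ≥1 α β (suc _) δ _ = s≤s z≤n
γ+δ≥1 α β zero (suc _) _ = s≤s z≤n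

α+β≥1 : ∀ α β γ δ → Det≡1 α β γ δ → 1 ℕ.≤ α ℕ.+ β
α+β≥1 zero zero γ δ det with trans (sym (e (+ δ) (+ γ))) det
  where e : ∀ x y → + 0 * x - + 0 * y ≡ 0ℤ
        e = solve-∀
... | ()
α+β≥1 (suc _) β γ δ _ = s≤s z≤n
α+β≥1 zero (suc _) γ δ _ = s≤s z≤n

-- The mixed case γ ≤ α, β < δ forces α ≤ 1 (from αδ - βγ = 1), leaving I₂ and R.
LRFactor-α≤1 : ∀ α β γ δ → α ℕ.≤ 1 → γ ℕ.≤ α → β ℕ.< δ → Det≡1 α β γ δ → LRFactor α β γ δ
LRFactor-α≤1 zero β γ δ _ _ _ det = ⊥-elim (nonneg-≢-neg 0 (nonneg-* (nonneg-ℕ β) (nonneg-ℕ γ)) (trans (e (+ β) (+ γ) (+ δ)) (cong -_ det)))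
  where e : ∀ y z w → y * z ≡ - (+ 0 * w - y * z)
        e = solve-∀
LRFactor-α≤1 (suc zero) β zero δ _ _ β<δ det with ℤP.+-injective (trans (sym (e (+ δ) (+ β))) det)
  where e : ∀ w y → + 1 * w - y * + 0 ≡ w
        e = solve-∀
LRFactor-α≤1 (suc zero) zero zero .1 _ _ _ _ | refl = identity refl
LRFactor-α≤1 (suc zero) (suc _) zero .1 _ _ (s≤s ()) _ | refl
LRFactor-α≤1 (suc zero) β (suc zero) δ _ _ β<δ det = R-factor-of ℕP.≤-refl (ℕP.<⇒≤ β<δ) det (s≤s z≤n)
LRFactor-α≤1 (suc zero) β (suc (suc _)) δ _ (s≤s ()) _ _
LRFactor-α≤1 (suc (suc _)) β γ δ (s≤s ()) _ _ _

lrFactor : ∀ α β γ δ → Det≡1 α β γ δ → LRFactor α β γ δ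
lrFactor α β γ δ det with γ ℕ.≤? α | δ ℕ.≤? β
... | yes γ≤α | yes δ≤β = L-factor-of γ≤α δ≤β det (γ+δ≥1 α β γ δ det)
... | no γ≰α | no δ≰β = R-factor-of (ℕP.<⇒≤ (ℕP.≰⇒> γ≰α)) (ℕP.<⇒≤ (ℕP.≰⇒> δ≰β)) det (α+β≥1 α β γ δ det)
... | no γ≰α | yes δ≤β = ⊥-elim (nonneg-≢-neg 0 certificate (trans (e (+ α) (+ β) (+ γ) (+ δ)) (cong -_ det)))
  where
  certificate : NonNeg ((+ β - + δ) * + γ + + δ * (+ γ - + α - 1ℤ) + + δ)
  certificate = nonneg-+ (nonneg-+ (nonneg-* (≤⇒nonneg (+≤+ δ≤β)) (nonneg-ℕ γ)) (nonneg-* (nonneg-ℕ δ) (nonneg-pred (<⇒pos (+<+ (ℕP.≰⇒> γ≰α)))))) (nonneg-ℕ δ)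
  e : ∀ x y z w → (y - w) * z + w * (z - x - 1ℤ) + w ≡ - (x * w - y * z)
  e = solve-∀
... | yes γ≤α | no δ≰β = LRFactor-α≤1 α β γ δ α≤1 γ≤α (ℕP.≰⇒> δ≰β) det
  where
  certificate : NonNeg (+ α * (+ δ - + β - 1ℤ) + + β * (+ α - + γ))
  certificate = nonneg-+ (nonneg-* (nonneg-ℕ α) (nonneg-pred (<⇒pos (+<+ (ℕP.≰⇒> δ≰β))))) (nonneg-* (nonneg-ℕ β) (≤⇒nonneg (+≤+ γ≤α)))
  e : ∀ x y z w → x * w - y * z ≡ 1ℤ → x * (w - y - 1ℤ) + y * (x - z) ≡ 1ℤ - x
  e x y z w h = trans (e′ x y z w) (cong (_- x) h)
    where e′ : ∀ x y z w → x * (w - y - 1ℤ) + y * (x - z) ≡ x * w - y * z - x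
          e′ = solve-∀
  α≤1 : α ℕ.≤ 1
  α≤1 = ℤP.drop‿+≤+ (nonneg⇒≤ {x = + α} {y = 1ℤ} (subst NonNeg (e (+ α) (+ β) (+ γ) (+ δ) det) certificate))

nonnegSL₂⇒LRWord : ∀ α β γ δ → Det≡1 α β γ δ → LRWord (matℕ α β γ δ)
nonnegSL₂⇒LRWord α β γ δ = go (suc (entrySum α β γ δ)) α β γ δ (ℕP.n<1+n _)
  where
  go : ∀ bound α β γ δ → entrySum α β γ δ ℕ.< bound → Det≡1 α β γ δ → LRWord (matℕ α β γ δ)
  go (suc bound) α β γ δ (s≤s size≤bound) det with lrFactor α β γ δ det
  ... | identity M≡I = subst LRWord (sym M≡I) []
  ... | L-factor α′ β′ γ′ δ′ M≡LM′ det′ smaller = subst LRWord M≡LM′ (L∷ go bound α′ β′ γ′ δ′ (ℕP.<-≤-trans smaller size≤bound) det′)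
  ... | R-factor α′ β′ γ′ δ′ M≡RM′ det′ smaller = subst LRWord M≡RM′ (R∷ go bound α′ β′ γ′ δ′ (ℕP.<-≤-trans smaller size≤bound) det′)

NonNegRelated : Form → Form → Set
NonNegRelated r₁ r₂ = ∃[ α ] ∃[ β ] ∃[ γ ] ∃[ δ ] (Det≡1 α β γ δ × r₁ ≡ r₂ ∣∣ matℕ α β γ δ)

nonNegRelated : ∀ {r₁ r₂ α β γ δ} → NonNeg α → NonNeg β → NonNeg γ → NonNeg δ →
  α * δ - β * γ ≡ 1ℤ → r₁ ≡ r₂ ∣∣ mat α β γ δ → NonNegRelated r₁ r₂
nonNegRelated {α = + α} {+ β} {+ γ} {+ δ} _ _ _ _ det r₁≡r₂M = α , β , γ , δ , det , r₁≡r₂M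
nonNegRelated {α = -[1+ _ ]} (nonneg ()) _ _ _ _ _
nonNegRelated {α = + _} {β = -[1+ _ ]} _ (nonneg ()) _ _ _ _
nonNegRelated {α = + _} {+ _} { -[1+ _ ]} _ _ (nonneg ()) _ _ _
nonNegRelated {α = + _} {+ _} {+ _} { -[1+ _ ]} _ _ _ (nonneg ()) _ _

∣∣-adj : ∀ {r₁ r₂} M → det M ≡ 1ℤ → r₁ ≡ r₂ ∣∣ M → r₂ ≡ r₁ ∣∣ adj M
∣∣-adj {r₁} {r₂} M det-M r₁≡r₂M =
  sym (trans (cong (_∣∣ adj M) r₁≡r₂M) (trans (∣∣-⊗ r₂ M (adj M)) (trans (cong (r₂ ∣∣_) (⊗-adj M det-M)) (∣∣-I₂ r₂))))

pos-products-≢1 : ∀ {x y u v} → Pos x → Pos y → Pos u → Pos v → x * y + u * v ≢ 1ℤ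
pos-products-≢1 {x} {y} {u} {v} px py pu pv h =
  nonneg-≢-neg 0 (nonneg-+ (nonneg-pred (pos-* px py)) (nonneg-pred (pos-* pu pv))) (trans (e x y u v) (cong (_- + 2) h))
  where e : ∀ x y u v → x * y - 1ℤ + (u * v - 1ℤ) ≡ x * y + u * v - + 2
        e = solve-∀

NonNegRelated-by-signs : ∀ {r₁ r₂ α β γ δ} → Pos α → Pos δ → α * δ - β * γ ≡ 1ℤ → r₁ ≡ r₂ ∣∣ mat α β γ δ →
  NonNegRelated r₁ r₂ ⊎ NonNegRelated r₂ r₁
NonNegRelated-by-signs {r₁} {r₂} {α} {β} {γ} {δ} pα pδ det r₁≡r₂M with nonneg⊎pos-neg β | nonneg⊎pos-neg γ
... | inj₁ β≥0 | inj₁ γ≥0 = inj₁ (nonNegRelated {r₁} {r₂} (pos⇒nonneg pα) β≥0 γ≥0 (pos⇒nonneg pδ) det r₁≡r₂M)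
... | inj₂ β<0 | inj₂ γ<0 = inj₂ adjoint-related
  where adjoint-related = nonNegRelated {r₂} {r₁} (pos⇒nonneg pδ) (pos⇒nonneg β<0) (pos⇒nonneg γ<0) (pos⇒nonneg pα)
                            (trans (det-adj (mat α β γ δ)) det) (∣∣-adj (mat α β γ δ) det r₁≡r₂M)
... | inj₂ β<0 | inj₁ γ≥0 with nonneg⊎pos-neg (- γ)
...   | inj₁ -γ≥0 = inj₂ (nonNegRelated {r₂} {r₁} (pos⇒nonneg pδ) (pos⇒nonneg β<0) -γ≥0 (pos⇒nonneg pα)
                            (trans (det-adj (mat α β γ δ)) det) (∣∣-adj (mat α β γ δ) det r₁≡r₂M))
...   | inj₂ γ>0 = ⊥-elim (pos-products-≢1 pα pδ β<0 (subst Pos (ℤP.neg-involutive γ) γ>0) (trans (e α β γ δ) det))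
  where e : ∀ α β γ δ → α * δ + (- β) * γ ≡ α * δ - β * γ
        e = solve-∀
NonNegRelated-by-signs {r₁} {r₂} {α} {β} {γ} {δ} pα pδ det r₁≡r₂M | inj₁ β≥0 | inj₂ γ<0 with nonneg⊎pos-neg (- β)
...   | inj₁ -β≥0 = inj₂ (nonNegRelated {r₂} {r₁} (pos⇒nonneg pδ) -β≥0 (pos⇒nonneg γ<0) (pos⇒nonneg pα)
                            (trans (det-adj (mat α β γ δ)) det) (∣∣-adj (mat α β γ δ) det r₁≡r₂M))
...   | inj₂ β>0 = ⊥-elim (pos-products-≢1 pα pδ (subst Pos (ℤP.neg-involutive β) β>0) γ<0 (trans (e α β γ δ) det))
  where e : ∀ α β γ δ → α * δ + β * (- γ) ≡ α * δ - β * γ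
        e = solve-∀

PosNeg : Form → Set
PosNeg q = Pos (a q) × Pos (- c q)

Reduced : Form → Set
Reduced q = PosNeg q × (∣ a q + c q ∣ ℕ.< ∣ b q ∣)

Reduced⇒SimplyReduced : ∀ f → Reduced f → SimplyReduced f
Reduced⇒SimplyReduced f ((pa , pc) , ∣a+c∣<∣b∣) = pos⇒0< pa , pos-neg⇒<0 pc , ∣a+c∣<∣b∣

module _ {a b c α β γ δ : ℤ} (pa : Pos a) (a′>0 : Pos (a * α * α + b * α * γ + c * γ * γ)) where

  2aα+bγ≥0 : α * δ - β * γ ≡ 1ℤ → Pos (- (a * β * β + b * β * δ + c * δ * δ)) → Pos δ → NonNeg (+ 2 * a * α + b * γ)
  2aα+bγ≥0 det c′<0 pδ with nonneg⊎pos-neg (+ 2 * a * α + b * γ)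
  ... | inj₁ h = h
  ... | inj₂ h = ⊥-elim (nonneg-≢-neg 0 (nonneg-+ (nonneg-pred P′) Q) (e a b c α β γ δ))
    where
    Y = (- (+ 2 * a * α + b * γ)) * δ
    pY : Pos Y
    pY = pos-* h pδ
    P : Pos ((+ 2 * a * 1ℤ) * (+ 2 * a * 1ℤ + + 2 * Y))
    P = subst Pos (e₁ a Y) (pos-* (pos-ℕ* 3 pa) (pos {Y + a} (subst NonNeg (e₀ Y a) (nonneg-+ (nonneg-pred pY) (pos⇒nonneg pa)))))
      where e₁ : ∀ a Y → + 4 * a * (Y + a) ≡ (+ 2 * a * 1ℤ) * (+ 2 * a * 1ℤ + + 2 * Y)
            e₁ = solve-∀
            e₀ : ∀ Y a → Y - 1ℤ + a ≡ Y + a - 1ℤ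
            e₀ = solve-∀
    P′ : Pos ((+ 2 * a * (α * δ - β * γ)) * (+ 2 * a * (α * δ - β * γ) + + 2 * Y))
    P′ = subst (λ t → Pos ((+ 2 * a * t) * (+ 2 * a * t + + 2 * Y))) (sym det) P
    Q : NonNeg (+ 4 * a * (a * α * α + b * α * γ + c * γ * γ) * (δ * δ) + + 4 * a * (- (a * β * β + b * β * δ + c * δ * δ)) * (γ * γ))
    Q = nonneg-+ (nonneg-* (pos⇒nonneg (pos-* (pos-ℕ* 3 pa) a′>0)) (nonneg-square δ)) (nonneg-* (pos⇒nonneg (pos-* (pos-ℕ* 3 pa) c′<0)) (nonneg-square γ))
    e : ∀ a b c α β γ δ → (+ 2 * a * (α * δ - β * γ)) * (+ 2 * a * (α * δ - β * γ) + + 2 * ((- (+ 2 * a * α + b * γ)) * δ)) - 1ℤ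
         + (+ 4 * a * (a * α * α + b * α * γ + c * γ * γ) * (δ * δ) + + 4 * a * (- (a * β * β + b * β * δ + c * δ * δ)) * (γ * γ)) ≡ - + 1
    e = solve-∀

  α>0 : Pos (- c) → NonNeg (+ 2 * a * α + b * γ) → Pos α
  α>0 pc ℓ≥0 with nonneg⊎pos-neg (- α)
  ... | inj₂ h = subst Pos (ℤP.neg-involutive α) h
  ... | inj₁ -α≥0 = ⊥-elim (nonneg-≢-neg 0 (nonneg-+ (nonneg-+ (nonneg-* U V) (nonneg-pred (pos-* (pos-ℕ* 3 pa) a′>0)))
                                                  (nonneg-* (pos⇒nonneg (pos-* (pos-ℕ* 3 pa) pc)) (nonneg-square γ))) (e a b c α γ))
    where
    U : NonNeg (b * γ - (+ 2 * a * α + b * γ))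
    U = subst NonNeg (e₁ a α b γ) (nonneg-* (pos⇒nonneg (pos-ℕ* 1 pa)) -α≥0)
      where e₁ : ∀ a α b γ → + 2 * a * (- α) ≡ b * γ - (+ 2 * a * α + b * γ)
            e₁ = solve-∀
    V : NonNeg (b * γ + (+ 2 * a * α + b * γ))
    V = subst NonNeg (e₂ a α b γ) (nonneg-+ U (nonneg-* (nonneg-ℕ 2) ℓ≥0))
      where e₂ : ∀ a α b γ → b * γ - (+ 2 * a * α + b * γ) + + 2 * (+ 2 * a * α + b * γ) ≡ b * γ + (+ 2 * a * α + b * γ)
            e₂ = solve-∀
    e : ∀ a b c α γ → (b * γ - (+ 2 * a * α + b * γ)) * (b * γ + (+ 2 * a * α + b * γ))
                      + (+ 4 * a * (a * α * α + b * α * γ + c * γ * γ) - 1ℤ) + + 4 * a * (- c) * (γ * γ) ≡ - + 1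
    e = solve-∀

PosNeg-related-δ>0 : ∀ {r₁ r₂ α β γ δ} → PosNeg r₁ → PosNeg r₂ → α * δ - β * γ ≡ 1ℤ → r₁ ≡ r₂ ∣∣ mat α β γ δ → Pos δ →
  NonNegRelated r₁ r₂ ⊎ NonNegRelated r₂ r₁
PosNeg-related-δ>0 {r₁} {r₂} {α} {β} {γ} {δ} (a₁>0 , c₁<0) (a₂>0 , c₂<0) det r₁≡r₂M pδ =
  NonNegRelated-by-signs {r₁} {r₂} (α>0 {a r₂} {b r₂} {c r₂} {α} {β} {γ} {δ} a₂>0 a₁>0′ c₂<0 ℓ≥0) pδ det r₁≡r₂M
  where
  a₁>0′ : Pos (a r₂ * α * α + b r₂ * α * γ + c r₂ * γ * γ)
  a₁>0′ = subst Pos (cong a r₁≡r₂M) a₁>0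
  c₁<0′ : Pos (- (a r₂ * β * β + b r₂ * β * δ + c r₂ * δ * δ))
  c₁<0′ = subst (λ t → Pos (- t)) (cong c r₁≡r₂M) c₁<0
  ℓ≥0 : NonNeg (+ 2 * a r₂ * α + b r₂ * γ)
  ℓ≥0 = 2aα+bγ≥0 {a r₂} {b r₂} {c r₂} {α} {β} {γ} {δ} a₂>0 a₁>0′ det c₁<0′ pδ

PosNeg-related⇒NonNegRelated : ∀ {r₁ r₂} M → PosNeg r₁ → PosNeg r₂ → det M ≡ 1ℤ → r₁ ≡ r₂ ∣∣ M →
  NonNegRelated r₁ r₂ ⊎ NonNegRelated r₂ r₁
PosNeg-related⇒NonNegRelated {r₁} {r₂} (mat α β γ δ) pn₁ pn₂ det r₁≡r₂M with ℤP.<-cmp δ 0ℤ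
... | tri> _ _ δ>0 = PosNeg-related-δ>0 {r₁} {r₂} pn₁ pn₂ det r₁≡r₂M (0<⇒pos δ>0)
... | tri< δ<0 _ _ =
  PosNeg-related-δ>0 {r₁} {r₂} pn₁ pn₂ (trans (e α β γ δ) det) (trans r₁≡r₂M (sym (∣∣-neg r₂ α β γ δ))) (<0⇒pos-neg δ<0)
  where e : ∀ α β γ δ → (- α) * (- δ) - (- β) * (- γ) ≡ α * δ - β * γ
        e = solve-∀
... | tri≈ _ refl _ =
  ⊥-elim (nonneg-pos-neg-⊥ (subst NonNeg (e (a r₂) (b r₂) (c r₂) β) (nonneg-* (pos⇒nonneg (proj₁ pn₂)) (nonneg-square β)))
                           (subst (λ t → Pos (- t)) (cong c r₁≡r₂M) (proj₂ pn₁)))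
  where e : ∀ a b c β → a * (β * β) ≡ a * β * β + b * β * 0ℤ + c * 0ℤ * 0ℤ
        e = solve-∀

data UnitStep : Form → Form → Set where
  via-L : ∀ {p} → PosNeg (p ∣∣ Lpow 1ℤ) → UnitStep p (p ∣∣ Lpow 1ℤ)
  via-R : ∀ {p} → PosNeg (p ∣∣ Rpow 1ℤ) → UnitStep p (p ∣∣ Rpow 1ℤ)

PosNeg-UnitStep : ∀ {p p′} → UnitStep p p′ → PosNeg p′
PosNeg-UnitStep (via-L pn) = pn
PosNeg-UnitStep (via-R pn) = pn

disc-UnitStep : ∀ {p p′} → UnitStep p p′ → disc p′ ≡ disc p
disc-UnitStep {p} (via-L _) = disc-∣∣-SL₂ p (Lpow 1ℤ) (det-Lpow 1ℤ)
disc-UnitStep {p} (via-R _) = disc-∣∣-SL₂ p (Rpow 1ℤ) (det-Rpow 1ℤ)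

∣∣-Lpow-0 : ∀ q → q ∣∣ Lpow 0ℤ ≡ q
∣∣-Lpow-0 [ a , b , c ] = trans (∣∣-Lpow a b c 0ℤ) (form-≡ refl (e₁ a b) (e₂ a b c))
  where e₁ : ∀ a b → + 2 * a * 0ℤ + b ≡ b
        e₁ = solve-∀
        e₂ : ∀ a b c → a * 0ℤ * 0ℤ + b * 0ℤ + c ≡ c
        e₂ = solve-∀

module _ (D : ℕ) (nonsquare : ∀ m → m ℕ.* m ≢ D) where

  s : ℤ
  s = + isqrt D

  nonneg-s : NonNeg s
  nonneg-s = nonneg-ℕ (isqrt D)

  s²<D : Pos (+ D - s * s)
  s²<D = subst (λ t → Pos (+ D - t)) (ℤP.pos-* (isqrt D) (isqrt D))
           (<⇒pos (+<+ (ℕP.≤∧≢⇒< (proj₁ (isqrt-bounds D)) (nonsquare (isqrt D)))))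

  D<[s+1]² : Pos ((s + 1ℤ) * (s + 1ℤ) - + D)
  D<[s+1]² = subst (λ t → Pos (t - + D)) [s+1]² (<⇒pos (+<+ (proj₂ (isqrt-bounds D))))
    where
    r = isqrt D
    [s+1]² : + (suc r ℕ.* suc r) ≡ (s + 1ℤ) * (s + 1ℤ)
    [s+1]² = trans (ℤP.pos-* (suc r) (suc r)) (cong (λ t → + t * + t) (ℕP.+-comm 1 r))

  ∣u∣≤s⇒u²<D : ∀ u → NonNeg (s - u) → NonNeg (s + u) → Pos (+ D - u * u)
  ∣u∣≤s⇒u²<D u p q = pos (subst NonNeg (e (+ D) s u) (nonneg-+ (nonneg-pred s²<D) (nonneg-* p q)))
    where e : ∀ D S u → D - S * S - 1ℤ + (S - u) * (S + u) ≡ D - u * u - 1ℤ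
          e = solve-∀

  s<u⇒u²>D : ∀ u → NonNeg (u - s - 1ℤ) → Pos (u * u - + D)
  s<u⇒u²>D u p = pos (subst NonNeg (e (+ D) s u) (nonneg-+ (nonneg-* p u+s+1≥0) (nonneg-pred D<[s+1]²)))
    where
    u+s+1≥0 : NonNeg (u - s - 1ℤ + + 2 * (s + 1ℤ))
    u+s+1≥0 = nonneg-+ p (nonneg-* (nonneg-ℕ 2) (nonneg-+ nonneg-s (nonneg-ℕ 1)))
    e : ∀ D S u → (u - S - 1ℤ) * (u - S - 1ℤ + + 2 * (S + 1ℤ)) + ((S + 1ℤ) * (S + 1ℤ) - D - 1ℤ) ≡ u * u - D - 1ℤ
    e = solve-∀

  s<-u⇒u²>D : ∀ u → NonNeg (- u - s - 1ℤ) → Pos (u * u - + D)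
  s<-u⇒u²>D u p = subst Pos (e u (+ D)) (s<u⇒u²>D (- u) p)
    where e : ∀ u D → (- u) * (- u) - D ≡ u * u - D
          e = solve-∀

  u²<D⇒∣u∣≤s : ∀ u → Pos (+ D - u * u) → NonNeg (s - u) × NonNeg (s + u)
  u²<D⇒∣u∣≤s u p with nonneg⊎pos-neg (s - u) | nonneg⊎pos-neg (s + u)
  ... | inj₁ h₁ | inj₁ h₂ = h₁ , h₂
  ... | inj₂ h₁ | _ = ⊥-elim (pos-+-≢0 p (s<u⇒u²>D u (subst NonNeg (e s u) (nonneg-pred h₁))) (e′ (+ D) u))
    where e : ∀ S u → - (S - u) - 1ℤ ≡ u - S - 1ℤ
          e = solve-∀
          e′ : ∀ D u → D - u * u + (u * u - D) ≡ 0ℤ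
          e′ = solve-∀
  ... | inj₁ _ | inj₂ h₂ = ⊥-elim (pos-+-≢0 p (s<-u⇒u²>D u (subst NonNeg (e s u) (nonneg-pred h₂))) (e′ (+ D) u))
    where e : ∀ S u → - (S + u) - 1ℤ ≡ - u - S - 1ℤ
          e = solve-∀
          e′ : ∀ D u → D - u * u + (u * u - D) ≡ 0ℤ
          e′ = solve-∀

  u²>D⇒s<∣u∣ : ∀ u → Pos (u * u - + D) → NonNeg (u - s - 1ℤ) ⊎ NonNeg (- u - s - 1ℤ)
  u²>D⇒s<∣u∣ u p with nonneg⊎pos-neg (u - s - 1ℤ) | nonneg⊎pos-neg (- u - s - 1ℤ)
  ... | inj₁ h | _ = inj₁ h
  ... | inj₂ _ | inj₁ h = inj₂ h
  ... | inj₂ h₁ | inj₂ h₂ =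
    ⊥-elim (pos-+-≢0 p (∣u∣≤s⇒u²<D u (subst NonNeg (e₁ s u) (nonneg-pred h₁)) (subst NonNeg (e₂ s u) (nonneg-pred h₂))) (e₃ (+ D) u))
    where e₁ : ∀ S u → - (u - S - 1ℤ) - 1ℤ ≡ S - u
          e₁ = solve-∀
          e₂ : ∀ S u → - (- u - S - 1ℤ) - 1ℤ ≡ S + u
          e₂ = solve-∀
          e₃ : ∀ D u → u * u - D + (D - u * u) ≡ 0ℤ
          e₃ = solve-∀

  a>0∧4av>0⇒v>0 : ∀ {a v} → Pos a → Pos (+ 4 * a * v) → Pos v
  a>0∧4av>0⇒v>0 {a} {v} pa p = pos-cancelʳ {+ 4 * a} {v} (pos-ℕ* 3 pa) (subst Pos (e a v) p)
    where e : ∀ a v → + 4 * a * v ≡ v * (+ 4 * a)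
          e = solve-∀

  a>0∧4av<0⇒v<0 : ∀ {a v} → Pos a → Pos (- (+ 4 * a * v)) → Pos (- v)
  a>0∧4av<0⇒v<0 {a} {v} pa p = pos-cancelʳ {+ 4 * a} { - v} (pos-ℕ* 3 pa) (subst Pos (e a v) p)
    where e : ∀ a v → - (+ 4 * a * v) ≡ (- v) * (+ 4 * a)
          e = solve-∀

  a<0∧4av>0⇒v<0 : ∀ {a v} → Pos (- a) → Pos (+ 4 * a * v) → Pos (- v)
  a<0∧4av>0⇒v<0 {a} {v} pa p = pos-cancelʳ {+ 4 * (- a)} { - v} (pos-ℕ* 3 pa) (subst Pos (e a v) p)
    where e : ∀ a v → + 4 * a * v ≡ (- v) * (+ 4 * (- a))
          e = solve-∀

  a<0∧4av<0⇒v>0 : ∀ {a v} → Pos (- a) → Pos (- (+ 4 * a * v)) → Pos v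
  a<0∧4av<0⇒v>0 {a} {v} pa p = pos-cancelʳ {+ 4 * (- a)} {v} (pos-ℕ* 3 pa) (subst Pos (e a v) p)
    where e : ∀ a v → - (+ 4 * a * v) ≡ v * (+ 4 * (- a))
          e = solve-∀

  Disc : ℤ → ℤ → ℤ → Set
  Disc a b c = b * b - + 4 * a * c ≡ + D

  square-completion-x : ∀ a b c x → Disc a b c → (+ 2 * a * x + b) * (+ 2 * a * x + b) - + D ≡ + 4 * a * (a * x * x + b * x + c)
  square-completion-x a b c x d = trans (cong (λ t → (+ 2 * a * x + b) * (+ 2 * a * x + b) - t) (sym d)) (e a b c x)
    where e : ∀ a b c x → (+ 2 * a * x + b) * (+ 2 * a * x + b) - (b * b - + 4 * a * c) ≡ + 4 * a * (a * x * x + b * x + c)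
          e = solve-∀

  square-completion-y : ∀ a b c y → Disc a b c → (b + + 2 * c * y) * (b + + 2 * c * y) - + D ≡ + 4 * c * (a + b * y + c * y * y)
  square-completion-y a b c y d = trans (cong (λ t → (b + + 2 * c * y) * (b + + 2 * c * y) - t) (sym d)) (e a b c y)
    where e : ∀ a b c y → (b + + 2 * c * y) * (b + + 2 * c * y) - (b * b - + 4 * a * c) ≡ + 4 * c * (a + b * y + c * y * y)
          e = solve-∀

  b²-D≡4ac : ∀ a b c → Disc a b c → b * b - + D ≡ + 4 * a * c
  b²-D≡4ac a b c d = trans (cong (λ t → b * b - t) (sym d)) (e a b c)
    where e : ∀ a b c → b * b - (b * b - + 4 * a * c) ≡ + 4 * a * c
          e = solve-∀

  D-u²≡-[u²-D] : ∀ u {v} → u * u - + D ≡ v → + D - u * u ≡ - v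
  D-u²≡-[u²-D] u {v} h = trans (e u (+ D)) (cong -_ h)
    where e : ∀ u D → D - u * u ≡ - (u * u - D)
          e = solve-∀

  sign-a : ∀ a b c → Disc a b c → Pos a ⊎ Pos (- a)
  sign-a a b c d = ≢0⇒pos⊎pos-neg a a≢0
    where
    e : ∀ b c → b * b - + 4 * 0ℤ * c ≡ b * b
    e = solve-∀
    a≢0 : a ≢ 0ℤ
    a≢0 refl = nonsquare ∣ b ∣ (ℤP.+-injective (trans (sym (square≡abs² b)) (trans (sym (e b c)) d)))

  sign-c : ∀ a b c → Disc a b c → Pos c ⊎ Pos (- c)
  sign-c a b c d = sign-a c b a (trans (e a b c) d)
    where e : ∀ a b c → b * b - + 4 * c * a ≡ b * b - + 4 * a * c
          e = solve-∀

  floorPlus-pos : ∀ t m → Pos m → IsFloor (t + s) m (floorPlus D t m)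
  floorPlus-pos t (+ zero) (pos (nonneg ()))
  floorPlus-pos t (+ suc n) _ = /ℕ-isFloor (t + s) n
  floorPlus-pos t -[1+ n ] (pos (nonneg ()))

  floorPlus-neg : ∀ t m → Pos (- m) → IsFloor (- t - s - 1ℤ) (- m) (floorPlus D t m)
  floorPlus-neg t (+ n) p = ⊥-elim (nonneg-pos-neg-⊥ (nonneg-ℕ n) p)
  floorPlus-neg t -[1+ n ] _ = /ℕ-isFloor (- t - s - 1ℤ) n

  -- kL is ⌊ω⌋ for ω = (√D - b) / 2a; as √D is irrational, k < ω < k + 1 reads as follows.
  KLSpecPos KLSpecNeg : ℤ → ℤ → ℤ → Set
  KLSpecPos a b k = NonNeg (s - (+ 2 * a * k + b)) × Pos (+ 2 * a * (k + 1ℤ) + b - s)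
  KLSpecNeg a b k = Pos (+ 2 * a * k + b - s) × NonNeg (s - (+ 2 * a * (k + 1ℤ) + b))

  private
    neg-2a>0 : ∀ {a} → Pos (- a) → Pos (- (+ 2 * a))
    neg-2a>0 {a} pa = subst Pos (e a) (pos-ℕ* 1 pa)
      where e : ∀ a → + 2 * (- a) ≡ - (+ 2 * a)
            e = solve-∀

    e-pos₁ : ∀ a b k S → - b + S - k * (+ 2 * a) ≡ S - (+ 2 * a * k + b)
    e-pos₁ = solve-∀
    e-pos₂ : ∀ a b k S → (k + 1ℤ) * (+ 2 * a) - (- b + S) ≡ + 2 * a * (k + 1ℤ) + b - S
    e-pos₂ = solve-∀
    e-neg₁ : ∀ a b k S → - - b - S - 1ℤ - k * (- (+ 2 * a)) ≡ + 2 * a * k + b - S - 1ℤ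
    e-neg₁ = solve-∀
    e-neg₂ : ∀ a b k S → (k + 1ℤ) * (- (+ 2 * a)) - (- - b - S - 1ℤ) - 1ℤ ≡ S - (+ 2 * a * (k + 1ℤ) + b)
    e-neg₂ = solve-∀

    isFloor⇒KLSpecPos : ∀ a b k → IsFloor (- b + s) (+ 2 * a) k → KLSpecPos a b k
    isFloor⇒KLSpecPos a b k (p , q) = subst NonNeg (e-pos₁ a b k s) p , subst Pos (e-pos₂ a b k s) q

    KLSpecPos⇒isFloor : ∀ a b k → KLSpecPos a b k → IsFloor (- b + s) (+ 2 * a) k
    KLSpecPos⇒isFloor a b k (p , q) = subst NonNeg (sym (e-pos₁ a b k s)) p , subst Pos (sym (e-pos₂ a b k s)) q

    isFloor⇒KLSpecNeg : ∀ a b k → IsFloor (- - b - s - 1ℤ) (- (+ 2 * a)) k → KLSpecNeg a b k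
    isFloor⇒KLSpecNeg a b k (p , pos q) = pos (subst NonNeg (e-neg₁ a b k s) p) , subst NonNeg (e-neg₂ a b k s) q

    KLSpecNeg⇒isFloor : ∀ a b k → KLSpecNeg a b k → IsFloor (- - b - s - 1ℤ) (- (+ 2 * a)) k
    KLSpecNeg⇒isFloor a b k (pos p , q) = subst NonNeg (sym (e-neg₁ a b k s)) p , pos (subst NonNeg (sym (e-neg₂ a b k s)) q)

  kL-pos : ∀ a b c → Pos a → KLSpecPos a b (kL D [ a , b , c ])
  kL-pos a b c pa = isFloor⇒KLSpecPos a b _ (floorPlus-pos (- b) (+ 2 * a) (pos-ℕ* 1 pa))

  kL-neg : ∀ a b c → Pos (- a) → KLSpecNeg a b (kL D [ a , b , c ])
  kL-neg a b c pa = isFloor⇒KLSpecNeg a b _ (floorPlus-neg (- b) (+ 2 * a) (neg-2a>0 pa))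

  kL-pos-unique : ∀ a b c k → Pos a → KLSpecPos a b k → kL D [ a , b , c ] ≡ k
  kL-pos-unique a b c k pa spec =
    isFloor-unique (pos-ℕ* 1 pa) (floorPlus-pos (- b) (+ 2 * a) (pos-ℕ* 1 pa)) (KLSpecPos⇒isFloor a b k spec)

  kL-neg-unique : ∀ a b c k → Pos (- a) → KLSpecNeg a b k → kL D [ a , b , c ] ≡ k
  kL-neg-unique a b c k pa spec =
    isFloor-unique (neg-2a>0 pa) (floorPlus-neg (- b) (+ 2 * a) (neg-2a>0 pa)) (KLSpecNeg⇒isFloor a b k spec)
  -- 0 < ω < 1 and 1 < ω for the root ω = (√D - b) / 2a of q (x , 1), in the form of KLSpecPos/Neg
  RootInUnit : Form → Set
  RootInUnit q = (Pos (a q) × NonNeg (s - b q) × Pos (+ 2 * a q + b q - s))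
               ⊎ (Pos (- a q) × NonNeg (s - (+ 2 * a q + b q)) × Pos (b q - s))

  RootAboveOne : Form → Set
  RootAboveOne q = (Pos (a q) × NonNeg (s - (+ 2 * a q + b q))) ⊎ (Pos (- a q) × Pos (+ 2 * a q + b q - s))

  nonneg-s+1 : NonNeg (s + 1ℤ)
  nonneg-s+1 = nonneg-+ nonneg-s (nonneg-ℕ 1)

  PosNeg⇒∣b∣≤s : ∀ a b c → Disc a b c → Pos a → Pos (- c) → NonNeg (s - b) × NonNeg (s + b)
  PosNeg⇒∣b∣≤s a b c d pa pc = u²<D⇒∣u∣≤s b (subst Pos (trans (e a c) (sym (D-u²≡-[u²-D] b (b²-D≡4ac a b c d)))) (pos-* (pos-ℕ* 3 pa) pc))
    where e : ∀ a c → + 4 * a * (- c) ≡ - (+ 4 * a * c)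
          e = solve-∀

  shiftedL : ℤ → ℤ → ℤ → ℤ → Form
  shiftedL a b c k = [ a , + 2 * a * k + b , a * k * k + b * k + c ]

  shifted-RootInUnit : ∀ a b c → Disc a b c → RootInUnit (shiftedL a b c (kL D [ a , b , c ]))
  shifted-RootInUnit a b c d = [ a>0 , a<0 ]′ (sign-a a b c d)
    where
    k = kL D [ a , b , c ]
    e₁ : ∀ a b k S → + 2 * a * (k + 1ℤ) + b - S ≡ + 2 * a + (+ 2 * a * k + b) - S
    e₁ = solve-∀
    e₂ : ∀ a b k S → S - (+ 2 * a * (k + 1ℤ) + b) ≡ S - (+ 2 * a + (+ 2 * a * k + b))
    e₂ = solve-∀
    a>0 : Pos a → RootInUnit [ a , + 2 * a * k + b , a * k * k + b * k + c ]
    a>0 pa = inj₁ (pa , proj₁ (kL-pos a b c pa) , subst Pos (e₁ a b k s) (proj₂ (kL-pos a b c pa)))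
    a<0 : Pos (- a) → RootInUnit [ a , + 2 * a * k + b , a * k * k + b * k + c ]
    a<0 pa = inj₂ (pa , subst NonNeg (e₂ a b k s) (proj₂ (kL-neg a b c pa)) , proj₁ (kL-neg a b c pa))

  -- (2ak + b)² - D = 4a q (k , 1), so |2ak + b| ≤ s gives q (k , 1) < 0.
  shifted-PosNeg : ∀ a b c k → Disc a b c → Pos a → Pos (- c) → KLSpecPos a b k → PosNeg (shiftedL a b c k)
  shifted-PosNeg a b c k d pa pc (s-u≥0 , u′>s) =
    pa , a>0∧4av<0⇒v<0 pa (subst Pos (D-u²≡-[u²-D] u (square-completion-x a b c k d)) (∣u∣≤s⇒u²<D u s-u≥0 s+u≥0))
    where
    u = + 2 * a * k + b
    ∣b∣≤s = PosNeg⇒∣b∣≤s a b c d pa pc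
    k≥0 : NonNeg k
    k≥0 = subst NonNeg (e₂ k) (nonneg-pred (pos-cancelʳ {+ 2 * a} {k + 1ℤ} (pos-ℕ* 1 pa) (pos (subst NonNeg (e₁ a b k s) (nonneg-+ (nonneg-pred u′>s) (proj₁ ∣b∣≤s))))))
      where e₁ : ∀ a b k S → + 2 * a * (k + 1ℤ) + b - S - 1ℤ + (S - b) ≡ (k + 1ℤ) * (+ 2 * a) - 1ℤ
            e₁ = solve-∀
            e₂ : ∀ k → k + 1ℤ - 1ℤ ≡ k
            e₂ = solve-∀
    s+u≥0 : NonNeg (s + u)
    s+u≥0 = subst NonNeg (e a b k s) (nonneg-+ (proj₂ ∣b∣≤s) (nonneg-* (pos⇒nonneg (pos-ℕ* 1 pa)) k≥0))
      where e : ∀ a b k S → S + b + + 2 * a * k ≡ S + (+ 2 * a * k + b)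
            e = solve-∀

  PosNeg-shiftedByKL : ∀ a b c → Disc a b c → PosNeg [ a , b , c ] → PosNeg (shiftedL a b c (kL D [ a , b , c ]))
  PosNeg-shiftedByKL a b c d (pa , pc) = shifted-PosNeg a b c (kL D [ a , b , c ]) d pa pc (kL-pos a b c pa)

  shifted-∣b∣<∣b∣-a>0 : ∀ a b c k → Disc a b c → Pos a → Pos c → NonNeg (s - (+ 2 * a + b)) → KLSpecPos a b k → ∣ + 2 * a * k + b ∣ ℕ.< ∣ b ∣
  shifted-∣b∣<∣b∣-a>0 a b c k d pa pc w (h₁ , h₂) = [ b>s , -b>s ]′ (u²>D⇒s<∣u∣ b (subst Pos (sym (b²-D≡4ac a b c d)) (pos-* (pos-ℕ* 3 pa) pc)))
    where
    e : ∀ a b S → S - (+ 2 * a + b) + (b - S - 1ℤ) + + 2 * (a - 1ℤ) ≡ - + 3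
    e = solve-∀
    e₁ : ∀ a b k S → - b - S - 1ℤ + (S - (+ 2 * a * k + b)) ≡ - b - (+ 2 * a * k + b) - 1ℤ
    e₁ = solve-∀
    e₂ : ∀ a b k S → + 2 * a * (k + 1ℤ) + b - S - 1ℤ + (S - (+ 2 * a + b)) ≡ - b + (+ 2 * a * k + b) - 1ℤ
    e₂ = solve-∀
    b>s : NonNeg (b - s - 1ℤ) → ∣ + 2 * a * k + b ∣ ℕ.< ∣ b ∣
    b>s b>s = ⊥-elim (nonneg-≢-neg 2 (nonneg-+ (nonneg-+ w b>s) (nonneg-* (nonneg-ℕ 2) (nonneg-pred pa))) (e a b s))
    -b>s : NonNeg (- b - s - 1ℤ) → ∣ + 2 * a * k + b ∣ ℕ.< ∣ b ∣
    -b>s -b>s = subst (∣ + 2 * a * k + b ∣ ℕ.<_) (ℤP.∣-i∣≡∣i∣ b)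
      (∣y∣<∣x∣-from-pos (- b) (+ 2 * a * k + b) (pos (subst NonNeg (e₁ a b k s) (nonneg-+ -b>s h₁)))
                                                (pos (subst NonNeg (e₂ a b k s) (nonneg-+ (nonneg-pred h₂) w))))

  shifted-∣b∣<∣b∣-a<0 : ∀ a b k → Pos (- a) → Pos (+ 2 * a + b - s) → KLSpecNeg a b k → ∣ + 2 * a * k + b ∣ ℕ.< ∣ b ∣
  shifted-∣b∣<∣b∣-a<0 a b k pa w (h₁ , h₂) = ∣y∣<∣x∣-from-pos b (+ 2 * a * k + b)
      (pos (subst NonNeg (e₁ a b k s) (nonneg-+ (nonneg-pred w) h₂)))
      (pos (subst NonNeg (e₂ a b k s) (nonneg-+ (nonneg-+ (nonneg-pred w) (pos⇒nonneg (pos-ℕ* 1 pa)))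
                                                 (nonneg-+ (nonneg-+ (nonneg-pred h₁) (nonneg-* (nonneg-ℕ 2) nonneg-s)) (nonneg-ℕ 1)))))
    where e₁ : ∀ a b k S → + 2 * a + b - S - 1ℤ + (S - (+ 2 * a * (k + 1ℤ) + b)) ≡ b - (+ 2 * a * k + b) - 1ℤ
          e₁ = solve-∀
          e₂ : ∀ a b k S → + 2 * a + b - S - 1ℤ + + 2 * (- a) + (+ 2 * a * k + b - S - 1ℤ + + 2 * S + + 1) ≡ b + (+ 2 * a * k + b) - 1ℤ
          e₂ = solve-∀

  shifted-descent : ∀ a b c → Disc a b c → RootAboveOne [ a , b , c ] → PosNeg [ a , b , c ] ⊎ (∣ + 2 * a * kL D [ a , b , c ] + b ∣ ℕ.< ∣ b ∣)
  shifted-descent a b c d (inj₁ (pa , w)) =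
    [ (λ pc → inj₂ (shifted-∣b∣<∣b∣-a>0 a b c (kL D [ a , b , c ]) d pa pc w (kL-pos a b c pa))) , (λ pc → inj₁ (pa , pc)) ]′ (sign-c a b c d)
  shifted-descent a b c d (inj₂ (pa , w)) = inj₂ (shifted-∣b∣<∣b∣-a<0 a b (kL D [ a , b , c ]) pa w (kL-neg a b c pa))

  -- The middle coefficient u = 2ak + b of q ∣∣ L^k dominates a + c′ for c′ = q (k , 1), since
  -- a + c′ ± u = q (k ± 1 , 1) and 4a q (k ± 1 , 1) = (u ± 2a)² - D has the sign of ± 1.
  shifted-Reduced : ∀ a b c k → Disc a b c → Pos a → Pos (- c) → NonNeg (s - (+ 2 * a + b)) → KLSpecPos a b k →
    Reduced (shiftedL a b c k)
  shifted-Reduced a b c k d pa pc w (h₁ , h₂) =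
    shifted-PosNeg a b c k d pa pc (h₁ , h₂) , ∣y∣<∣x∣-from-pos u (a + (a * k * k + b * k + c)) u>a+c′ u>-[a+c′]
    where
    u = + 2 * a * k + b
    ∣b∣≤s = PosNeg⇒∣b∣≤s a b c d pa pc
    u>-[a+c′] : Pos (u + (a + (a * k * k + b * k + c)))
    u>-[a+c′] = subst Pos (e a b c k) (a>0∧4av>0⇒v>0 pa (subst Pos (square-completion-x a b c (k + 1ℤ) d) (s<u⇒u²>D (+ 2 * a * (k + 1ℤ) + b) (nonneg-pred h₂))))
      where e : ∀ a b c k → a * (k + 1ℤ) * (k + 1ℤ) + b * (k + 1ℤ) + c ≡ + 2 * a * k + b + (a + (a * k * k + b * k + c))
            e = solve-∀
    k>0 : Pos k
    k>0 = pos-cancelʳ {+ 2 * a} {k} (pos-ℕ* 1 pa) (pos (subst NonNeg (e a b k s) (nonneg-+ (nonneg-pred h₂) w)))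
      where e : ∀ a b k S → + 2 * a * (k + 1ℤ) + b - S - 1ℤ + (S - (+ 2 * a + b)) ≡ k * (+ 2 * a) - 1ℤ
            e = solve-∀
    u₋ = + 2 * a * (k - 1ℤ) + b
    s-u₋≥0 : NonNeg (s - u₋)
    s-u₋≥0 = subst NonNeg (e a b k s) (nonneg-+ h₁ (pos⇒nonneg (pos-ℕ* 1 pa)))
      where e : ∀ a b k S → S - (+ 2 * a * k + b) + + 2 * a ≡ S - (+ 2 * a * (k - 1ℤ) + b)
            e = solve-∀
    s+u₋≥0 : NonNeg (s + u₋)
    s+u₋≥0 = subst NonNeg (e a b k s) (nonneg-+ (proj₂ ∣b∣≤s) (nonneg-* (pos⇒nonneg (pos-ℕ* 1 pa)) (nonneg-pred k>0)))
      where e : ∀ a b k S → S + b + + 2 * a * (k - 1ℤ) ≡ S + (+ 2 * a * (k - 1ℤ) + b)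
            e = solve-∀
    u>a+c′ : Pos (u - (a + (a * k * k + b * k + c)))
    u>a+c′ = subst Pos (e a b c k) (a>0∧4av<0⇒v<0 pa (subst Pos (D-u²≡-[u²-D] u₋ (square-completion-x a b c (k - 1ℤ) d)) (∣u∣≤s⇒u²<D u₋ s-u₋≥0 s+u₋≥0)))
      where e : ∀ a b c k → - (a * (k - 1ℤ) * (k - 1ℤ) + b * (k - 1ℤ) + c) ≡ + 2 * a * k + b - (a + (a * k * k + b * k + c))
            e = solve-∀

  Reduced-shiftedByKL : ∀ a b c → Disc a b c → PosNeg [ a , b , c ] → RootAboveOne [ a , b , c ] →
    Reduced (shiftedL a b c (kL D [ a , b , c ]))
  Reduced-shiftedByKL a b c d (pa , pc) (inj₁ (_ , w)) = shifted-Reduced a b c (kL D [ a , b , c ]) d pa pc w (kL-pos a b c pa)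
  Reduced-shiftedByKL a b c d (pa , pc) (inj₂ (na , _)) = ⊥-elim (pos-+-≢0 pa na (ℤP.+-inverseʳ a))

  -- 0 < ω < 1 with a > 0 gives q (1 , 1) > 0, which puts the root of τ q = [ - c , - b , - a ] above 1.
  RootInUnit⇒RootAboveOne-τ-a>0 : ∀ a b c → Disc a b c → Pos a → NonNeg (s - b) → Pos (+ 2 * a + b - s) → RootAboveOne [ - c , - b , - a ]
  RootInUnit⇒RootAboveOne-τ-a>0 a b c d pa s-b≥0 2a+b>s = [ c>0 , c<0 ]′ (sign-c a b c d)
    where
    u = b + + 2 * c * 1ℤ
    q[1,1]>0 : Pos (a + b + c)
    q[1,1]>0 = subst Pos (e a b c) (a>0∧4av>0⇒v>0 pa (subst Pos (square-completion-x a b c 1ℤ d) (s<u⇒u²>D (+ 2 * a * 1ℤ + b) (subst NonNeg (e₀ a b s) (nonneg-pred 2a+b>s)))))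
      where e : ∀ a b c → a * 1ℤ * 1ℤ + b * 1ℤ + c ≡ a + b + c
            e = solve-∀
            e₀ : ∀ a b S → + 2 * a + b - S - 1ℤ ≡ + 2 * a * 1ℤ + b - S - 1ℤ
            e₀ = solve-∀
    c<0 : Pos (- c) → RootAboveOne [ - c , - b , - a ]
    c<0 pc = inj₁ (pc , subst NonNeg (e₁ b c s) (proj₂ (u²<D⇒∣u∣≤s u u²<D)))
      where
      e₁ : ∀ b c S → S + (b + + 2 * c * 1ℤ) ≡ S - (+ 2 * (- c) + (- b))
      e₁ = solve-∀
      e₂ : ∀ a b c → + 4 * (- c) * (a + b + c) ≡ - (+ 4 * c * (a + b * 1ℤ + c * 1ℤ * 1ℤ))
      e₂ = solve-∀
      u²<D : Pos (+ D - u * u)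
      u²<D = subst Pos (trans (e₂ a b c) (sym (D-u²≡-[u²-D] u (square-completion-y a b c 1ℤ d)))) (pos-* (pos-ℕ* 3 pc) q[1,1]>0)
    certificate-identity : ∀ a b c S D → D ≡ b * b - + 4 * a * c →
      (+ 2 * a + b - S - 1ℤ) * (b + + 2 * c * 1ℤ - S - 1ℤ) + (S - b + 1ℤ) * ((+ 2 * a + b - S - 1ℤ) + (b + + 2 * c * 1ℤ - S - 1ℤ))
        + + 2 * ((S + 1ℤ) * (S - b)) + (D - S * S - 1ℤ) + 1ℤ ≡ - + 1
    certificate-identity a b c S _ refl = e a b c S
      where e : ∀ a b c S →
              (+ 2 * a + b - S - 1ℤ) * (b + + 2 * c * 1ℤ - S - 1ℤ) + (S - b + 1ℤ) * ((+ 2 * a + b - S - 1ℤ) + (b + + 2 * c * 1ℤ - S - 1ℤ))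
                + + 2 * ((S + 1ℤ) * (S - b)) + (b * b - + 4 * a * c - S * S - 1ℤ) + 1ℤ ≡ - + 1
            e = solve-∀
    c>0 : Pos c → RootAboveOne [ - c , - b , - a ]
    c>0 pc = [ u>s , -u>s ]′ (u²>D⇒s<∣u∣ u (subst Pos (sym (square-completion-y a b c 1ℤ d)) (subst Pos (e a b c) (pos-* (pos-ℕ* 3 pc) q[1,1]>0))))
      where
      e : ∀ a b c → + 4 * c * (a + b + c) ≡ + 4 * c * (a + b * 1ℤ + c * 1ℤ * 1ℤ)
      e = solve-∀
      -u>s : NonNeg (- u - s - 1ℤ) → RootAboveOne [ - c , - b , - a ]
      -u>s h = inj₂ (subst Pos (sym (ℤP.neg-involutive c)) pc , pos (subst NonNeg (e′ b c s) h))
        where e′ : ∀ b c S → - (b + + 2 * c * 1ℤ) - S - 1ℤ ≡ + 2 * (- c) + (- b) - S - 1ℤ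
              e′ = solve-∀
      u>s : NonNeg (u - s - 1ℤ) → RootAboveOne [ - c , - b , - a ]
      u>s h = ⊥-elim (nonneg-≢-neg 0 certificate (certificate-identity a b c s (+ D) (sym d)))
        where
        certificate : NonNeg ((+ 2 * a + b - s - 1ℤ) * (u - s - 1ℤ) + (s - b + 1ℤ) * ((+ 2 * a + b - s - 1ℤ) + (u - s - 1ℤ))
                              + + 2 * ((s + 1ℤ) * (s - b)) + (+ D - s * s - 1ℤ) + 1ℤ)
        certificate = nonneg-+ (nonneg-+ (nonneg-+ (nonneg-+ (nonneg-* (nonneg-pred 2a+b>s) h) (nonneg-* (nonneg-+ s-b≥0 (nonneg-ℕ 1)) (nonneg-+ (nonneg-pred 2a+b>s) h)))
                        (nonneg-* (nonneg-ℕ 2) (nonneg-* nonneg-s+1 s-b≥0))) (nonneg-pred s²<D)) (nonneg-ℕ 1)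

  RootInUnit⇒RootAboveOne-τ-a<0 : ∀ a b c → Disc a b c → Pos (- a) → NonNeg (s - (+ 2 * a + b)) → Pos (b - s) → RootAboveOne [ - c , - b , - a ]
  RootInUnit⇒RootAboveOne-τ-a<0 a b c d pa s-[2a+b]≥0 b>s = inj₁ (pc , [ id , ⊥-elim ∘ impossible ]′ (nonneg⊎pos-neg (s - (+ 2 * (- c) + (- b)))))
    where
    u = b + + 2 * c * 1ℤ
    pc : Pos (- c)
    pc = a<0∧4av>0⇒v<0 pa (subst Pos (b²-D≡4ac a b c d) (s<u⇒u²>D b (nonneg-pred b>s)))
    impossible : Pos (- (s - (+ 2 * (- c) + (- b)))) → ⊥
    impossible h = [ 2a+b>s , -[2a+b]>s ]′ (u²>D⇒s<∣u∣ (+ 2 * a * 1ℤ + b) (subst Pos (sym (square-completion-x a b c 1ℤ d)) (subst Pos (e₃ a b c) (pos-* (pos-ℕ* 3 pa) q[1,1]<0))))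
      where
      -u>s : NonNeg (- u - s - 1ℤ)
      -u>s = subst NonNeg (e₁ b c s) (nonneg-pred h)
        where e₁ : ∀ b c S → - (S - (+ 2 * (- c) + (- b))) - 1ℤ ≡ - (b + + 2 * c * 1ℤ) - S - 1ℤ
              e₁ = solve-∀
      q[1,1]<0 : Pos (- (a + b * 1ℤ + c * 1ℤ * 1ℤ))
      q[1,1]<0 = a<0∧4av>0⇒v<0 pc (subst Pos (square-completion-y a b c 1ℤ d) (s<-u⇒u²>D u -u>s))
      e₃ : ∀ a b c → + 4 * (- a) * (- (a + b * 1ℤ + c * 1ℤ * 1ℤ)) ≡ + 4 * a * (a * 1ℤ * 1ℤ + b * 1ℤ + c)
      e₃ = solve-∀
      2a+b>s : NonNeg (+ 2 * a * 1ℤ + b - s - 1ℤ) → ⊥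
      2a+b>s x = nonneg-≢-neg 0 (nonneg-+ x s-[2a+b]≥0) (e a b s)
        where e : ∀ a b S → + 2 * a * 1ℤ + b - S - 1ℤ + (S - (+ 2 * a + b)) ≡ - + 1
              e = solve-∀
      -[2a+b]>s : NonNeg (- (+ 2 * a * 1ℤ + b) - s - 1ℤ) → ⊥
      -[2a+b]>s x = nonneg-≢-neg 0 certificate (certificate-identity a b c s (+ D) (sym d))
        where
        t≥0 : NonNeg (b - s - 1ℤ + + 2 * (s + 1ℤ))
        t≥0 = nonneg-+ (nonneg-pred b>s) (nonneg-* (nonneg-ℕ 2) nonneg-s+1)
        certificate : NonNeg ((- (+ 2 * a * 1ℤ + b) - s - 1ℤ) * (- u - s - 1ℤ) + (b - s - 1ℤ + + 2 * (s + 1ℤ)) * ((- (+ 2 * a * 1ℤ + b) - s - 1ℤ) + (- u - s - 1ℤ))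
                              + + 2 * ((s + 1ℤ) * (b - s - 1ℤ)) + (+ D - s * s - 1ℤ) + + 3 * ((s + 1ℤ) * (s + 1ℤ)) + s * s)
        certificate = nonneg-+ (nonneg-+ (nonneg-+ (nonneg-+ (nonneg-+ (nonneg-* x -u>s) (nonneg-* t≥0 (nonneg-+ x -u>s))) (nonneg-* (nonneg-ℕ 2) (nonneg-* nonneg-s+1 (nonneg-pred b>s))))
                        (nonneg-pred s²<D)) (nonneg-* (nonneg-ℕ 3) (nonneg-square (s + 1ℤ)))) (nonneg-square s)
        certificate-identity : ∀ a b c S D → D ≡ b * b - + 4 * a * c →
          (- (+ 2 * a * 1ℤ + b) - S - 1ℤ) * (- (b + + 2 * c * 1ℤ) - S - 1ℤ)
            + (b - S - 1ℤ + + 2 * (S + 1ℤ)) * ((- (+ 2 * a * 1ℤ + b) - S - 1ℤ) + (- (b + + 2 * c * 1ℤ) - S - 1ℤ))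
            + + 2 * ((S + 1ℤ) * (b - S - 1ℤ)) + (D - S * S - 1ℤ) + + 3 * ((S + 1ℤ) * (S + 1ℤ)) + S * S ≡ - + 1
        certificate-identity a b c S _ refl = e a b c S
          where e : ∀ a b c S →
                  (- (+ 2 * a * 1ℤ + b) - S - 1ℤ) * (- (b + + 2 * c * 1ℤ) - S - 1ℤ)
                    + (b - S - 1ℤ + + 2 * (S + 1ℤ)) * ((- (+ 2 * a * 1ℤ + b) - S - 1ℤ) + (- (b + + 2 * c * 1ℤ) - S - 1ℤ))
                    + + 2 * ((S + 1ℤ) * (b - S - 1ℤ)) + (b * b - + 4 * a * c - S * S - 1ℤ) + + 3 * ((S + 1ℤ) * (S + 1ℤ)) + S * S ≡ - + 1
                e = solve-∀

  RootInUnit⇒RootAboveOne-τ : ∀ a b c → Disc a b c → RootInUnit [ a , b , c ] → RootAboveOne [ - c , - b , - a ]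
  RootInUnit⇒RootAboveOne-τ a b c d (inj₁ (pa , h₁ , h₂)) = RootInUnit⇒RootAboveOne-τ-a>0 a b c d pa h₁ h₂
  RootInUnit⇒RootAboveOne-τ a b c d (inj₂ (pa , h₁ , h₂)) = RootInUnit⇒RootAboveOne-τ-a<0 a b c d pa h₁ h₂

  -- τ q (x , y) = - q (y , x); conjugating by τ exchanges L and R.
  τ : Form → Form
  τ q = [ - c q , - b q , - a q ]

  ττ : ∀ q → τ (τ q) ≡ q
  ττ q = form-≡ (ℤP.neg-involutive (a q)) (ℤP.neg-involutive (b q)) (ℤP.neg-involutive (c q))

  disc-τ : ∀ q → disc (τ q) ≡ disc q
  disc-τ q = e (a q) (b q) (c q)
    where e : ∀ a b c → (- b) * (- b) - + 4 * (- c) * (- a) ≡ b * b - + 4 * a * c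
          e = solve-∀

  stepL-≡ : ∀ q → stepL D q ≡ shiftedL (a q) (b q) (c q) (kL D q)
  stepL-≡ q = ∣∣-Lpow (a q) (b q) (c q) (kL D q)

  disc-stepL : ∀ q → disc (stepL D q) ≡ disc q
  disc-stepL q = trans (cong disc (stepL-≡ q)) (e (a q) (b q) (c q) (kL D q))
    where e : ∀ a b c k → (+ 2 * a * k + b) * (+ 2 * a * k + b) - + 4 * a * (a * k * k + b * k + c) ≡ b * b - + 4 * a * c
          e = solve-∀

  kR≡kL-τ : ∀ q → kR D q ≡ kL D (τ q)
  kR≡kL-τ q = cong₂ (floorPlus D) (sym (ℤP.neg-involutive (b q))) (e (c q))
    where e : ∀ c → - (+ 2 * c) ≡ + 2 * (- c)
          e = solve-∀

  τ-∣∣Rpow : ∀ q k → τ (q ∣∣ Rpow k) ≡ τ q ∣∣ Lpow k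
  τ-∣∣Rpow q k = trans (cong τ (∣∣-Rpow (a q) (b q) (c q) k)) (trans (form-≡ refl (e₂ (b q) (c q) k) (e₃ (a q) (b q) (c q) k)) (sym (∣∣-Lpow (- c q) (- b q) (- a q) k)))
    where e₂ : ∀ b c k → - (b + + 2 * c * k) ≡ + 2 * (- c) * k + (- b)
          e₂ = solve-∀
          e₃ : ∀ a b c k → - (a + b * k + c * k * k) ≡ (- c) * k * k + (- b) * k + (- a)
          e₃ = solve-∀

  stepR≡τ∘stepL∘τ : ∀ q → stepR D q ≡ τ (stepL D (τ q))
  stepR≡τ∘stepL∘τ q = trans (sym (ττ (stepR D q))) (cong τ (trans (τ-∣∣Rpow q (kR D q)) (cong (λ k → τ q ∣∣ Lpow k) (kR≡kL-τ q))))

  disc-stepR : ∀ q → disc (stepR D q) ≡ disc q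
  disc-stepR q = trans (cong disc (stepR≡τ∘stepL∘τ q)) (trans (disc-τ (stepL D (τ q))) (trans (disc-stepL (τ q)) (disc-τ q)))

  PosNeg-τ : ∀ q → PosNeg q → PosNeg (τ q)
  PosNeg-τ q (pa , pc) = pc , subst Pos (sym (ℤP.neg-involutive (a q))) pa

  PosNeg-τ⁻ : ∀ q → PosNeg (τ q) → PosNeg q
  PosNeg-τ⁻ q h = subst PosNeg (ττ q) (PosNeg-τ (τ q) h)

  Reduced-τ : ∀ q → Reduced q → Reduced (τ q)
  Reduced-τ q (pc , r) = PosNeg-τ q pc , subst₂ ℕ._<_ (trans (sym (ℤP.∣-i∣≡∣i∣ (a q + c q))) (cong ∣_∣ (e (a q) (c q)))) (sym (ℤP.∣-i∣≡∣i∣ (b q))) r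
    where e : ∀ a c → - (a + c) ≡ - c + - a
          e = solve-∀

  RootInUnit-stepL : ∀ q → disc q ≡ + D → RootInUnit (stepL D q)
  RootInUnit-stepL q d = subst RootInUnit (sym (stepL-≡ q)) (shifted-RootInUnit (a q) (b q) (c q) d)

  RootAboveOne-stepR : ∀ q → disc q ≡ + D → RootAboveOne (stepR D q)
  RootAboveOne-stepR q d = subst RootAboveOne (sym (stepR≡τ∘stepL∘τ q)) (RootInUnit⇒RootAboveOne-τ (a p) (b p) (c p) dp (RootInUnit-stepL (τ q) dτ))
    where
    p = stepL D (τ q)
    dτ = trans (disc-τ q) d
    dp = trans (disc-stepL (τ q)) dτ

  PosNeg-stepL : ∀ q → disc q ≡ + D → PosNeg q → PosNeg (stepL D q)
  PosNeg-stepL q d h = subst PosNeg (sym (stepL-≡ q)) (PosNeg-shiftedByKL (a q) (b q) (c q) d h)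

  PosNeg-stepR : ∀ q → disc q ≡ + D → PosNeg q → PosNeg (stepR D q)
  PosNeg-stepR q d h = subst PosNeg (sym (stepR≡τ∘stepL∘τ q)) (PosNeg-τ (stepL D (τ q)) (PosNeg-stepL (τ q) (trans (disc-τ q) d) (PosNeg-τ q h)))

  Reduced-stepL : ∀ q → disc q ≡ + D → PosNeg q → RootAboveOne q → Reduced (stepL D q)
  Reduced-stepL q d h w = subst Reduced (sym (stepL-≡ q)) (Reduced-shiftedByKL (a q) (b q) (c q) d h w)

  Reduced-stepR : ∀ q → disc q ≡ + D → PosNeg q → RootInUnit q → Reduced (stepR D q)
  Reduced-stepR q d h w = subst Reduced (sym (stepR≡τ∘stepL∘τ q))
    (Reduced-τ (stepL D (τ q)) (Reduced-stepL (τ q) (trans (disc-τ q) d) (PosNeg-τ q h) (RootInUnit⇒RootAboveOne-τ (a q) (b q) (c q) d w)))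

  descent-stepL : ∀ q → disc q ≡ + D → RootAboveOne q → PosNeg q ⊎ (∣ b (stepL D q) ∣ ℕ.< ∣ b q ∣)
  descent-stepL q d w = Sum.map₂ (subst (λ p → ∣ b p ∣ ℕ.< ∣ b q ∣) (sym (stepL-≡ q))) (shifted-descent (a q) (b q) (c q) d w)

  descent-stepR : ∀ q → disc q ≡ + D → RootInUnit q → PosNeg q ⊎ (∣ b (stepR D q) ∣ ℕ.< ∣ b q ∣)
  descent-stepR q d w =
    Sum.map (PosNeg-τ⁻ q) (subst₂ ℕ._<_ ∣b∣-stepR ∣b∣-τ) (descent-stepL (τ q) (trans (disc-τ q) d) (RootInUnit⇒RootAboveOne-τ (a q) (b q) (c q) d w))
    where
    ∣b∣-stepR : ∣ b (stepL D (τ q)) ∣ ≡ ∣ b (stepR D q) ∣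
    ∣b∣-stepR = trans (sym (ℤP.∣-i∣≡∣i∣ (b (stepL D (τ q))))) (cong (λ p → ∣ b p ∣) (sym (stepR≡τ∘stepL∘τ q)))
    ∣b∣-τ : ∣ b (τ q) ∣ ≡ ∣ b q ∣
    ∣b∣-τ = ℤP.∣-i∣≡∣i∣ (b q)

  disc-stepRL : ∀ q → disc q ≡ + D → disc (stepRL D q) ≡ + D
  disc-stepRL q d = trans (cong disc (stepRL-unfold D q)) (trans (disc-stepR (stepL D q)) (trans (disc-stepL q) d))

  disc-iterate : ∀ q k → disc q ≡ + D → disc (iterate (stepRL D) q k) ≡ + D
  disc-iterate q zero d = d
  disc-iterate q (suc k) d = disc-iterate (stepRL D q) k (disc-stepRL q d)

  PosNeg-stepRL : ∀ q → disc q ≡ + D → PosNeg q → PosNeg (stepRL D q)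
  PosNeg-stepRL q d pn = subst PosNeg (sym (stepRL-unfold D q)) (PosNeg-stepR (stepL D q) (trans (disc-stepL q) d) (PosNeg-stepL q d pn))

  RootAboveOne-stepRL : ∀ q → disc q ≡ + D → RootAboveOne (stepRL D q)
  RootAboveOne-stepRL q d = subst RootAboveOne (sym (stepRL-unfold D q)) (RootAboveOne-stepR (stepL D q) (trans (disc-stepL q) d))

  PosNeg-iterate : ∀ q k → disc q ≡ + D → PosNeg q → PosNeg (iterate (stepRL D) q k)
  PosNeg-iterate q zero d pn = pn
  PosNeg-iterate q (suc k) d pn = PosNeg-iterate (stepRL D q) k (disc-stepRL q d) (PosNeg-stepRL q d pn)

  mutual
    seqL-Reduced : ∀ q → disc q ≡ + D → Reduced q → RootAboveOne q → ∀ n → Reduced (seqL D q n)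
    seqL-Reduced q d red w zero = red
    seqL-Reduced q d red w (suc n) =
      seqR-Reduced (stepL D q) (trans (disc-stepL q) d) (Reduced-stepL q d (proj₁ red) w) (RootInUnit-stepL q d) n

    seqR-Reduced : ∀ q → disc q ≡ + D → Reduced q → RootInUnit q → ∀ n → Reduced (seqR D q n)
    seqR-Reduced q d red w zero = red
    seqR-Reduced q d red w (suc n) =
      seqL-Reduced (stepR D q) (trans (disc-stepR q) d) (Reduced-stepR q d (proj₁ red) w) (RootAboveOne-stepR q d) n

  descent-stepRL : ∀ y → disc y ≡ + D → RootAboveOne y → PosNeg (stepL D y) ⊎ ∣ b (stepRL D y) ∣ ℕ.< ∣ b y ∣
  descent-stepRL y d w = [ inj₁ ∘ PosNeg-stepL y d , after-stepL ]′ (descent-stepL y d w)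
    where
    after-stepL : ∣ b (stepL D y) ∣ ℕ.< ∣ b y ∣ → PosNeg (stepL D y) ⊎ ∣ b (stepRL D y) ∣ ℕ.< ∣ b y ∣
    after-stepL lt₁ = Sum.map₂ (λ lt₂ → subst (λ x → ∣ b x ∣ ℕ.< ∣ b y ∣) (sym (stepRL-unfold D y)) (ℕP.<-trans lt₂ lt₁))
                        (descent-stepR (stepL D y) (trans (disc-stepL y) d) (RootInUnit-stepL y d))

  reach-PosNeg : ∀ m y → disc y ≡ + D → RootAboveOne y → ∣ b y ∣ ℕ.< m → ∃[ k ] PosNeg (stepL D (iterate (stepRL D) y k))
  reach-PosNeg (suc m) y d w (s≤s ∣b∣≤m) = [ (λ pn → 0 , pn) , recurse ]′ (descent-stepRL y d w)
    where
    recurse : ∣ b (stepRL D y) ∣ ℕ.< ∣ b y ∣ → ∃[ k ] PosNeg (stepL D (iterate (stepRL D) y k))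
    recurse lt = Product.map suc id (reach-PosNeg m (stepRL D y) (disc-stepRL y d) (RootAboveOne-stepRL y d) (ℕP.<-≤-trans lt ∣b∣≤m))

  eventually-Reduced : ∀ q → disc q ≡ + D → ∃[ k ] (Reduced (iterate (stepRL D) q k) × RootAboveOne (iterate (stepRL D) q k))
  eventually-Reduced q d = two-more (reach-PosNeg _ (stepRL D q) (disc-stepRL q d) (RootAboveOne-stepRL q d) (ℕP.n<1+n _))
    where
    two-more : ∃[ k ] PosNeg (stepL D (iterate (stepRL D) (stepRL D q) k)) →
      ∃[ k ] (Reduced (iterate (stepRL D) q k) × RootAboveOne (iterate (stepRL D) q k))
    two-more (k , pn) = suc (suc k) ,
      subst Reduced (sym next) (Reduced-stepR (stepL D z) dz′ pn (RootInUnit-stepL z dz)) , subst RootAboveOne (sym next) (RootAboveOne-stepR (stepL D z) dz′)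
      where
      z = iterate (stepRL D) (stepRL D q) k
      dz : disc z ≡ + D
      dz = disc-iterate (stepRL D q) k (disc-stepRL q d)
      dz′ : disc (stepL D z) ≡ + D
      dz′ = trans (disc-stepL z) dz
      next : iterate (stepRL D) q (suc (suc k)) ≡ stepR D (stepL D z)
      next = trans (iterate-suc (stepRL D) (stepRL D q) k) (stepRL-unfold D z)

  PosNeg-bounded : ∀ q → disc q ≡ + D → PosNeg q → ∣ a q ∣ ℕ.≤ D × ∣ b q ∣ ℕ.≤ D × ∣ c q ∣ ℕ.≤ D
  PosNeg-bounded [ a , b , c ] d (pa , pc) =
    ∣x∣≤n a D D-a≥0 (nonneg-+ (nonneg-ℕ D) (pos⇒nonneg pa)) ,
    ℕP.≤-trans (∣x∣≤n b (isqrt D) (proj₁ ∣b∣≤s) (proj₂ ∣b∣≤s)) (isqrt-≤ D) ,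
    ∣x∣≤n c D (subst NonNeg (e (+ D) c) (nonneg-+ (nonneg-ℕ D) (pos⇒nonneg pc))) D+c≥0
    where
    ∣b∣≤s = PosNeg⇒∣b∣≤s a b c d pa pc
    e : ∀ D c → D + - c ≡ D - c
    e = solve-∀
    e-a : ∀ a b c → b * b + a * (+ 4 * (- c - 1ℤ) + + 3) ≡ b * b - + 4 * a * c - a
    e-a = solve-∀
    e-c : ∀ a b c → b * b + (- c) * (+ 4 * (a - 1ℤ) + + 3) ≡ b * b - + 4 * a * c + c
    e-c = solve-∀
    D-a≥0 : NonNeg (+ D - a)
    D-a≥0 = subst (λ t → NonNeg (t - a)) d (subst NonNeg (e-a a b c)
              (nonneg-+ (nonneg-square b) (nonneg-* (pos⇒nonneg pa) (nonneg-+ (nonneg-* (nonneg-ℕ 4) (nonneg-pred pc)) (nonneg-ℕ 3)))))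
    D+c≥0 : NonNeg (+ D + c)
    D+c≥0 = subst (λ t → NonNeg (t + c)) d (subst NonNeg (e-c a b c)
              (nonneg-+ (nonneg-square b) (nonneg-* (pos⇒nonneg pc) (nonneg-+ (nonneg-* (nonneg-ℕ 4) (nonneg-pred pa)) (nonneg-ℕ 3)))))

  seqL-eventuallyPeriodic : ∀ q → disc q ≡ + D → EventuallyPeriodic (seqL D q)
  seqL-eventuallyPeriodic q d = from-reduced (eventually-Reduced q d)
    where
    from-reduced : ∃[ k ] (Reduced (iterate (stepRL D) q k) × RootAboveOne (iterate (stepRL D) q k)) → EventuallyPeriodic (seqL D q)
    from-reduced (k , (pn , _) , _) = from-repeat (pigeonhole (formsWithin D) (iterate (stepRL D) x) x-bounded)
      where
      x = iterate (stepRL D) q k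
      dx = disc-iterate q k d
      x-bounded : ∀ i → iterate (stepRL D) x i ∈ formsWithin D
      x-bounded i = let (∣a∣≤D , ∣b∣≤D , ∣c∣≤D) = PosNeg-bounded (iterate (stepRL D) x i) (disc-iterate x i dx) (PosNeg-iterate x i dx pn)
                    in ∈-formsWithin (iterate (stepRL D) x i) ∣a∣≤D ∣b∣≤D ∣c∣≤D
      from-repeat : ∃[ i ] ∃[ j ] (i ℕ.< j × iterate (stepRL D) x i ≡ iterate (stepRL D) x j) → EventuallyPeriodic (seqL D q)
      from-repeat (i , j , i<j , xᵢ≡xⱼ) =
        (k ℕ.+ i) ℕ.* 2 , (j ∸ i) ℕ.* 2 , ℕP.*-monoˡ-< 2 (ℕP.m<n⇒0<n∸m i<j) ,
        periodic-iterate⇒periodic-seqL D q (k ℕ.+ i) (j ∸ i) period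
        where
        open ≡-Reasoning
        p = j ∸ i
        period : iterate (stepRL D) q (p ℕ.+ (k ℕ.+ i)) ≡ iterate (stepRL D) q (k ℕ.+ i)
        period = begin
          iterate (stepRL D) q (p ℕ.+ (k ℕ.+ i)) ≡⟨ cong (iterate (stepRL D) q) (ℕP.+-comm p (k ℕ.+ i)) ⟩
          iterate (stepRL D) q (k ℕ.+ i ℕ.+ p)   ≡⟨ cong (iterate (stepRL D) q) (ℕP.+-assoc k i p) ⟩
          iterate (stepRL D) q (k ℕ.+ (i ℕ.+ p)) ≡⟨ iterate-+ (stepRL D) q k (i ℕ.+ p) ⟩
          iterate (stepRL D) x (i ℕ.+ p)         ≡⟨ cong (iterate (stepRL D) x) (ℕP.m+[n∸m]≡n (ℕP.<⇒≤ i<j)) ⟩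
          iterate (stepRL D) x j                 ≡⟨ sym xᵢ≡xⱼ ⟩
          iterate (stepRL D) x i                 ≡⟨ sym (iterate-+ (stepRL D) q k i) ⟩
          iterate (stepRL D) q (k ℕ.+ i)         ∎

  InCycle⇒Reduced : ∀ q → disc q ≡ + D → ∀ f → InCycle (seqL D q) f → Reduced f
  InCycle⇒Reduced q d f f∈cycle = from-reduced (eventually-Reduced q d)
    where
    from-reduced : ∃[ k ] (Reduced (iterate (stepRL D) q k) × RootAboveOne (iterate (stepRL D) q k)) → Reduced f
    from-reduced (k , red , w) = occurrence (f∈cycle (k ℕ.* 2))
      where
      occurrence : ∃[ n ] (k ℕ.* 2 ℕ.≤ n × seqL D q n ≡ f) → Reduced f
      occurrence (n , le , qₙ≡f) =
        subst Reduced (trans (sym (seqL-after D k q n le)) qₙ≡f) (seqL-Reduced _ (disc-iterate q k d) red w (n ∸ k ℕ.* 2))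

  kL-∣∣Lpow : ∀ a b c c′ j → Disc a b c → kL D [ a , + 2 * a * j + b , c′ ] ≡ kL D [ a , b , c ] - j
  kL-∣∣Lpow a b c c′ j d = [ a>0 , a<0 ]′ (sign-a a b c d)
    where
    k = kL D [ a , b , c ]
    a>0 : Pos a → kL D [ a , + 2 * a * j + b , c′ ] ≡ k - j
    a>0 pa = kL-pos-unique a (+ 2 * a * j + b) c′ (k - j) pa
               (subst NonNeg (e₁ a b k j s) (proj₁ (kL-pos a b c pa)) , subst Pos (e₂ a b k j s) (proj₂ (kL-pos a b c pa)))
      where e₁ : ∀ a b k j S → S - (+ 2 * a * k + b) ≡ S - (+ 2 * a * (k - j) + (+ 2 * a * j + b))
            e₁ = solve-∀
            e₂ : ∀ a b k j S → + 2 * a * (k + 1ℤ) + b - S ≡ + 2 * a * (k - j + 1ℤ) + (+ 2 * a * j + b) - S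
            e₂ = solve-∀
    a<0 : Pos (- a) → kL D [ a , + 2 * a * j + b , c′ ] ≡ k - j
    a<0 pa = kL-neg-unique a (+ 2 * a * j + b) c′ (k - j) pa
               (subst Pos (e₁ a b k j s) (proj₁ (kL-neg a b c pa)) , subst NonNeg (e₂ a b k j s) (proj₂ (kL-neg a b c pa)))
      where e₁ : ∀ a b k j S → + 2 * a * k + b - S ≡ + 2 * a * (k - j) + (+ 2 * a * j + b) - S
            e₁ = solve-∀
            e₂ : ∀ a b k j S → S - (+ 2 * a * (k + 1ℤ) + b) ≡ S - (+ 2 * a * (k - j + 1ℤ) + (+ 2 * a * j + b))
            e₂ = solve-∀

  stepL-∣∣Lpow : ∀ q j → disc q ≡ + D → stepL D (q ∣∣ Lpow j) ≡ stepL D q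
  stepL-∣∣Lpow q j d = begin
    (q ∣∣ Lpow j) ∣∣ Lpow (kL D (q ∣∣ Lpow j)) ≡⟨ cong (λ k → (q ∣∣ Lpow j) ∣∣ Lpow k) kL-shifted ⟩
    (q ∣∣ Lpow j) ∣∣ Lpow (kL D q - j)         ≡⟨ ∣∣-⊗ q (Lpow j) (Lpow (kL D q - j)) ⟩
    q ∣∣ (Lpow j ⊗ Lpow (kL D q - j))          ≡⟨ cong (q ∣∣_) (Lpow-⊗ j (kL D q - j)) ⟩
    q ∣∣ Lpow (j + (kL D q - j))               ≡⟨ cong (λ k → q ∣∣ Lpow k) (e j (kL D q)) ⟩
    q ∣∣ Lpow (kL D q)                         ∎
    where
    open ≡-Reasoning
    kL-shifted : kL D (q ∣∣ Lpow j) ≡ kL D q - j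
    kL-shifted = trans (cong (kL D) (∣∣-Lpow (a q) (b q) (c q) j)) (kL-∣∣Lpow (a q) (b q) (c q) (a q * j * j + b q * j + c q) j d)
    e : ∀ j k → j + (k - j) ≡ k
    e = solve-∀

  stepR-∣∣Rpow : ∀ q j → disc q ≡ + D → stepR D (q ∣∣ Rpow j) ≡ stepR D q
  stepR-∣∣Rpow q j d = begin
    stepR D (q ∣∣ Rpow j)          ≡⟨ stepR≡τ∘stepL∘τ (q ∣∣ Rpow j) ⟩
    τ (stepL D (τ (q ∣∣ Rpow j)))  ≡⟨ cong (λ p → τ (stepL D p)) (τ-∣∣Rpow q j) ⟩
    τ (stepL D (τ q ∣∣ Lpow j))    ≡⟨ cong τ (stepL-∣∣Lpow (τ q) j (trans (disc-τ q) d)) ⟩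
    τ (stepL D (τ q))              ≡⟨ sym (stepR≡τ∘stepL∘τ q) ⟩
    stepR D q                      ∎
    where open ≡-Reasoning

  stepL-fixed⇒SameCycle : ∀ x → stepL D x ≡ x → SameCycle (seqL D x) (seqR D x)
  stepL-fixed⇒SameCycle x fixed =
    SameCycle-trans (SameCycle-shift (seqL D x) 1) (SameCycle-pointwise (λ n → cong (λ y → seqR D y n) fixed))

  stepR-fixed⇒SameCycle : ∀ x → stepR D x ≡ x → SameCycle (seqL D x) (seqR D x)
  stepR-fixed⇒SameCycle x fixed =
    SameCycle-sym (SameCycle-trans (SameCycle-shift (seqR D x) 1) (SameCycle-pointwise (λ n → cong (λ y → seqL D y n) fixed)))

  a+b+c≢0 : ∀ q → disc q ≡ + D → a q + b q + c q ≢ 0ℤ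
  a+b+c≢0 q d a+b+c≡0 = nonsquare ∣ a q - c q ∣ (ℤP.+-injective (trans (sym (square≡abs² (a q - c q))) (trans (e (a q) (b q) (c q) a+b+c≡0) d)))
    where
    e : ∀ a b c → a + b + c ≡ 0ℤ → (a - c) * (a - c) ≡ b * b - + 4 * a * c
    e a b c h = trans (e₁ a c) (cong (λ t → t * t - + 4 * a * c) (sym (trans (e₂ a b c) (cong (λ t → t - a - c) h))))
      where e₁ : ∀ a c → (a - c) * (a - c) ≡ (0ℤ - a - c) * (0ℤ - a - c) - + 4 * a * c
            e₁ = solve-∀
            e₂ : ∀ a b c → b ≡ a + b + c - a - c
            e₂ = solve-∀

  stepL-fixed : ∀ p → disc p ≡ + D → PosNeg p → Pos (a p + b p + c p) → stepL D p ≡ p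
  stepL-fixed p d (pa , pc) a+b+c>0 = trans (cong (λ k → p ∣∣ Lpow k) kL≡0) (∣∣-Lpow-0 p)
    where
    A = a p
    B = b p
    C = c p
    ∣B∣≤s = PosNeg⇒∣b∣≤s A B C d pa pc
    [2A+B]²>D : Pos ((+ 2 * A * 1ℤ + B) * (+ 2 * A * 1ℤ + B) - + D)
    [2A+B]²>D = subst Pos (sym (square-completion-x A B C 1ℤ d)) (subst Pos (e A B C) (pos-* (pos-ℕ* 3 pa) a+b+c>0))
      where e : ∀ a b c → + 4 * a * (a + b + c) ≡ + 4 * a * (a * 1ℤ * 1ℤ + b * 1ℤ + c)
            e = solve-∀
    2A+B>s : NonNeg (+ 2 * A * 1ℤ + B - s - 1ℤ) ⊎ NonNeg (- (+ 2 * A * 1ℤ + B) - s - 1ℤ) → Pos (+ 2 * A * (0ℤ + 1ℤ) + B - s)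
    2A+B>s (inj₁ x) = pos (subst NonNeg (e A B s) x)
      where e : ∀ a b S → + 2 * a * 1ℤ + b - S - 1ℤ ≡ + 2 * a * (0ℤ + 1ℤ) + b - S - 1ℤ
            e = solve-∀
    2A+B>s (inj₂ x) = ⊥-elim (nonneg-≢-neg 2 (nonneg-+ (nonneg-+ x (proj₂ ∣B∣≤s)) (nonneg-* (nonneg-ℕ 2) (nonneg-pred pa))) (e A B s))
      where e : ∀ a b S → - (+ 2 * a * 1ℤ + b) - S - 1ℤ + (S + b) + + 2 * (a - 1ℤ) ≡ - + 3
            e = solve-∀
    kL≡0 : kL D p ≡ 0ℤ
    kL≡0 = kL-pos-unique A B C 0ℤ pa (subst NonNeg (e A B s) (proj₁ ∣B∣≤s) , 2A+B>s (u²>D⇒s<∣u∣ (+ 2 * A * 1ℤ + B) [2A+B]²>D))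
      where e : ∀ a b S → S - b ≡ S - (+ 2 * a * 0ℤ + b)
            e = solve-∀

  stepR-fixed : ∀ p → disc p ≡ + D → PosNeg p → Pos (- (a p + b p + c p)) → stepR D p ≡ p
  stepR-fixed p d pn a+b+c<0 =
    trans (stepR≡τ∘stepL∘τ p) (trans (cong τ (stepL-fixed (τ p) (trans (disc-τ p) d) (PosNeg-τ p pn) (subst Pos (e (a p) (b p) (c p)) a+b+c<0))) (ττ p))
    where e : ∀ a b c → - (a + b + c) ≡ - c + - b + - a
          e = solve-∀

  -- For a > 0 > c one of kL and kR vanishes, by the sign of q (1 , 1) = a + b + c.
  PosNeg⇒SameCycle-LR : ∀ p → disc p ≡ + D → PosNeg p → SameCycle (seqL D p) (seqR D p)
  PosNeg⇒SameCycle-LR p d pn =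
    [ stepL-fixed⇒SameCycle p ∘ stepL-fixed p d pn , stepR-fixed⇒SameCycle p ∘ stepR-fixed p d pn ]′
      (≢0⇒pos⊎pos-neg (a p + b p + c p) (a+b+c≢0 p d))

  SameCycle-UnitStep : ∀ {p p′} → disc p ≡ + D → PosNeg p → UnitStep p p′ → SameCycle (seqL D p′) (seqL D p)
  SameCycle-UnitStep {p} d pn (via-L _) =
    SameCycle-trans (SameCycle-shift (seqL D (p ∣∣ Lpow 1ℤ)) 1)
      (SameCycle-trans (SameCycle-pointwise (λ n → cong (λ y → seqR D y n) (stepL-∣∣Lpow p 1ℤ d)))
        (SameCycle-sym (SameCycle-shift (seqL D p) 1)))
  SameCycle-UnitStep {p} d pn (via-R pn′) =
    SameCycle-trans (PosNeg⇒SameCycle-LR p′ (trans (disc-∣∣-SL₂ p (Rpow 1ℤ) (det-Rpow 1ℤ)) d) pn′)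
      (SameCycle-trans (SameCycle-shift (seqR D p′) 1)
        (SameCycle-trans (SameCycle-pointwise (λ n → cong (λ y → seqL D y n) (stepR-∣∣Rpow p 1ℤ d)))
          (SameCycle-trans (SameCycle-sym (SameCycle-shift (seqR D p) 1)) (SameCycle-sym (PosNeg⇒SameCycle-LR p d pn)))))
    where p′ = p ∣∣ Rpow 1ℤ

  SameCycle-UnitSteps : ∀ {p r} → disc p ≡ + D → PosNeg p → Star UnitStep p r → SameCycle (seqL D r) (seqL D p)
  SameCycle-UnitSteps d pn ε = SameCycle-refl
  SameCycle-UnitSteps d pn (step ◅ steps) =
    SameCycle-trans (SameCycle-UnitSteps (trans (disc-UnitStep step) d) (PosNeg-UnitStep step) steps) (SameCycle-UnitStep d pn step)

  -- ω q < 0 for the root ω = (√D - b) / 2a of q (x , 1)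
  RootNegative : Form → Set
  RootNegative q = (Pos (a q) × NonNeg (b q - s - 1ℤ)) ⊎ (Pos (- a q) × NonNeg (s - b q))

  -- 1 / ω q < 0, read off from 1 / ω = (- b - √D) / 2c
  CoRootNegative : Form → Set
  CoRootNegative q = (Pos (c q) × NonNeg (s + b q)) ⊎ (Pos (- c q) × NonNeg (- b q - s - 1ℤ))

  b²-D≡4ca : ∀ a b c → Disc a b c → b * b - + D ≡ + 4 * c * a
  b²-D≡4ca a b c d = trans (b²-D≡4ac a b c d) (e a c)
    where e : ∀ a c → + 4 * a * c ≡ + 4 * c * a
          e = solve-∀

  RootNegative⇒CoRootNegative : ∀ q → disc q ≡ + D → RootNegative q → CoRootNegative q
  RootNegative⇒CoRootNegative q d (inj₁ (pa , h)) = inj₁ (a>0∧4av>0⇒v>0 pa (subst Pos (b²-D≡4ac (a q) (b q) (c q) d) (s<u⇒u²>D (b q) h)) ,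
                                   subst NonNeg (e (b q) s) (nonneg-+ (nonneg-+ h (nonneg-* (nonneg-ℕ 2) nonneg-s)) (nonneg-ℕ 1)))
    where e : ∀ b S → b - S - 1ℤ + + 2 * S + + 1 ≡ S + b
          e = solve-∀
  RootNegative⇒CoRootNegative q d (inj₂ (na , h)) = [ s+b≥0 , s+b<0 ]′ (nonneg⊎pos-neg (s + b q))
    where
    s+b≥0 : NonNeg (s + b q) → CoRootNegative q
    s+b≥0 h′ = inj₁ (a<0∧4av<0⇒v>0 na (subst Pos (D-u²≡-[u²-D] (b q) (b²-D≡4ac (a q) (b q) (c q) d)) (∣u∣≤s⇒u²<D (b q) h h′)) , h′)
    s+b<0 : Pos (- (s + b q)) → CoRootNegative q
    s+b<0 h′ = inj₂ (a<0∧4av>0⇒v<0 na (subst Pos (b²-D≡4ac (a q) (b q) (c q) d) (s<-u⇒u²>D (b q) -b>s)) , -b>s)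
      where e : ∀ b S → - (S + b) - 1ℤ ≡ - b - S - 1ℤ
            e = solve-∀
            -b>s = subst NonNeg (e (b q) s) (nonneg-pred h′)

  CoRootNegative⇒RootNegative : ∀ q → disc q ≡ + D → CoRootNegative q → RootNegative q
  CoRootNegative⇒RootNegative q d (inj₁ (pc , h)) = [ s-b≥0 , s-b<0 ]′ (nonneg⊎pos-neg (s - b q))
    where
    s-b≥0 : NonNeg (s - b q) → RootNegative q
    s-b≥0 h′ = inj₂ (a>0∧4av<0⇒v<0 pc (subst Pos (D-u²≡-[u²-D] (b q) (b²-D≡4ca (a q) (b q) (c q) d)) (∣u∣≤s⇒u²<D (b q) h′ h)) , h′)
    s-b<0 : Pos (- (s - b q)) → RootNegative q
    s-b<0 h′ = inj₁ (a>0∧4av>0⇒v>0 pc (subst Pos (b²-D≡4ca (a q) (b q) (c q) d) (s<u⇒u²>D (b q) b>s)) , b>s)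
      where e : ∀ b S → - (S - b) - 1ℤ ≡ b - S - 1ℤ
            e = solve-∀
            b>s = subst NonNeg (e (b q) s) (nonneg-pred h′)
  CoRootNegative⇒RootNegative q d (inj₂ (nc , h)) = inj₂ (a<0∧4av>0⇒v<0 nc (subst Pos (b²-D≡4ca (a q) (b q) (c q) d) (s<-u⇒u²>D (b q) h)) ,
                                   subst NonNeg (e (b q) s) (nonneg-+ (nonneg-+ h (nonneg-* (nonneg-ℕ 2) nonneg-s)) (nonneg-ℕ 1)))
    where e : ∀ b S → - b - S - 1ℤ + + 2 * S + + 1 ≡ S - b
          e = solve-∀

  RootNegative-∣∣L¹ : ∀ q → RootNegative q → RootNegative (q ∣∣ Lpow 1ℤ)
  RootNegative-∣∣L¹ q h = subst RootNegative (sym (∣∣-Lpow (a q) (b q) (c q) 1ℤ)) (shifted h)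
    where
    shifted : RootNegative q → RootNegative [ a q , + 2 * a q * 1ℤ + b q , a q * 1ℤ * 1ℤ + b q * 1ℤ + c q ]
    shifted (inj₁ (pa , x)) = inj₁ (pa , subst NonNeg (e (a q) (b q) s) (nonneg-+ x (nonneg-* (nonneg-ℕ 2) (pos⇒nonneg pa))))
      where e : ∀ a b S → b - S - 1ℤ + + 2 * a ≡ + 2 * a * 1ℤ + b - S - 1ℤ
            e = solve-∀
    shifted (inj₂ (na , x)) = inj₂ (na , subst NonNeg (e (a q) (b q) s) (nonneg-+ x (nonneg-* (nonneg-ℕ 2) (pos⇒nonneg na))))
      where e : ∀ a b S → S - b + + 2 * (- a) ≡ S - (+ 2 * a * 1ℤ + b)
            e = solve-∀

  CoRootNegative-∣∣R¹ : ∀ q → CoRootNegative q → CoRootNegative (q ∣∣ Rpow 1ℤ)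
  CoRootNegative-∣∣R¹ q h = subst CoRootNegative (sym (∣∣-Rpow (a q) (b q) (c q) 1ℤ)) (shifted h)
    where
    shifted : CoRootNegative q → CoRootNegative [ a q + b q * 1ℤ + c q * 1ℤ * 1ℤ , b q + + 2 * c q * 1ℤ , c q ]
    shifted (inj₁ (pc , x)) = inj₁ (pc , subst NonNeg (e (b q) (c q) s) (nonneg-+ x (nonneg-* (nonneg-ℕ 2) (pos⇒nonneg pc))))
      where e : ∀ b c S → S + b + + 2 * c ≡ S + (b + + 2 * c * 1ℤ)
            e = solve-∀
    shifted (inj₂ (nc , x)) = inj₂ (nc , subst NonNeg (e (b q) (c q) s) (nonneg-+ x (nonneg-* (nonneg-ℕ 2) (pos⇒nonneg nc))))
      where e : ∀ b c S → - b - S - 1ℤ + + 2 * (- c) ≡ - (b + + 2 * c * 1ℤ) - S - 1ℤ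
            e = solve-∀

  RootNegative-∣∣R¹ : ∀ q → disc q ≡ + D → RootNegative q → RootNegative (q ∣∣ Rpow 1ℤ)
  RootNegative-∣∣R¹ q d h = CoRootNegative⇒RootNegative (q ∣∣ Rpow 1ℤ) (trans (disc-∣∣-SL₂ q (Rpow 1ℤ) (det-Rpow 1ℤ)) d)
                              (CoRootNegative-∣∣R¹ q (RootNegative⇒CoRootNegative q d h))

  PosNeg⇒¬RootNegative : ∀ q → disc q ≡ + D → PosNeg q → ¬ RootNegative q
  PosNeg⇒¬RootNegative q d (pa , pc) (inj₁ (_ , x)) = nonneg-≢-neg 0 (nonneg-+ x (proj₁ (PosNeg⇒∣b∣≤s (a q) (b q) (c q) d pa pc))) (e (b q) s)
    where e : ∀ b S → b - S - 1ℤ + (S - b) ≡ - + 1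
          e = solve-∀
  PosNeg⇒¬RootNegative q d (pa , pc) (inj₂ (na , _)) = pos-+-≢0 pa na (ℤP.+-inverseʳ (a q))

  PosNeg⇒RootNegative-negForm : ∀ q → disc q ≡ + D → PosNeg q → RootNegative (negForm q)
  PosNeg⇒RootNegative-negForm q d (pa , pc) = inj₂ (subst Pos (sym (ℤP.neg-involutive (a q))) pa ,
                                 subst NonNeg (e (b q) s) (proj₂ (PosNeg⇒∣b∣≤s (a q) (b q) (c q) d pa pc)))
    where e : ∀ b S → S + b ≡ S - (- b)
          e = solve-∀

  roots⇒PosNeg : ∀ q → disc q ≡ + D → ¬ RootNegative q → RootNegative (negForm q) → PosNeg q
  roots⇒PosNeg q d ¬neg (inj₁ (na , x)) = ⊥-elim (¬neg (inj₂ (na , subst NonNeg (e (b q) s) (nonneg-+ (nonneg-+ x (nonneg-* (nonneg-ℕ 2) nonneg-s)) (nonneg-ℕ 1)))))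
    where e : ∀ b S → - b - S - 1ℤ + + 2 * S + + 1 ≡ S - b
          e = solve-∀
  roots⇒PosNeg q d ¬neg (inj₂ (pa′ , x)) = pa , a>0∧4av<0⇒v<0 pa (subst Pos (D-u²≡-[u²-D] (b q) (b²-D≡4ac (a q) (b q) (c q) d)) (∣u∣≤s⇒u²<D (b q) s-b≥0 s+b≥0))
    where
    pa : Pos (a q)
    pa = subst Pos (ℤP.neg-involutive (a q)) pa′
    s+b≥0 : NonNeg (s + b q)
    s+b≥0 = subst NonNeg (e (b q) s) x
      where e : ∀ b S → S - (- b) ≡ S + b
            e = solve-∀
    b≤s : NonNeg (b q - s - 1ℤ) ⊎ Pos (- (b q - s - 1ℤ)) → NonNeg (s - b q)
    b≤s (inj₁ b>s) = ⊥-elim (¬neg (inj₁ (pa , b>s)))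
    b≤s (inj₂ b≤s) = subst NonNeg (e (b q) s) (nonneg-pred b≤s)
      where e : ∀ b S → - (b - S - 1ℤ) - 1ℤ ≡ S - b
            e = solve-∀
    s-b≥0 : NonNeg (s - b q)
    s-b≥0 = b≤s (nonneg⊎pos-neg (b q - s - 1ℤ))

  RootNegative-∣∣LRWord : ∀ {M} → LRWord M → ∀ q → disc q ≡ + D → RootNegative q → RootNegative (q ∣∣ M)
  RootNegative-∣∣LRWord [] q d neg = subst RootNegative (sym (∣∣-I₂ q)) neg
  RootNegative-∣∣LRWord (L∷_ {M} w) q d neg =
    subst RootNegative (∣∣-⊗ q (Lpow 1ℤ) M)
      (RootNegative-∣∣LRWord w (q ∣∣ Lpow 1ℤ) (trans (disc-∣∣-SL₂ q (Lpow 1ℤ) (det-Lpow 1ℤ)) d) (RootNegative-∣∣L¹ q neg))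
  RootNegative-∣∣LRWord (R∷_ {M} w) q d neg =
    subst RootNegative (∣∣-⊗ q (Rpow 1ℤ) M)
      (RootNegative-∣∣LRWord w (q ∣∣ Rpow 1ℤ) (trans (disc-∣∣-SL₂ q (Rpow 1ℤ) (det-Rpow 1ℤ)) d) (RootNegative-∣∣R¹ q d neg))

  -- Each letter keeps a > 0 > c: the root ω of the intermediate form cannot be negative, since
  -- negativity would persist to r ∣∣ M, while the conjugate root stays negative.
  LRWord⇒UnitSteps : ∀ {M} → LRWord M → ∀ r → disc r ≡ + D → PosNeg r → PosNeg (r ∣∣ M) → Star UnitStep r (r ∣∣ M)
  LRWord⇒UnitSteps [] r d pn pnM = subst (Star UnitStep r) (sym (∣∣-I₂ r)) ε
  LRWord⇒UnitSteps (L∷_ {M} w) r d pn pnM =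
    subst (Star UnitStep r) (∣∣-⊗ r (Lpow 1ℤ) M) (via-L pn′ ◅ LRWord⇒UnitSteps w r′ d′ pn′ pnM′)
    where
    r′ = r ∣∣ Lpow 1ℤ
    d′ = trans (disc-∣∣-SL₂ r (Lpow 1ℤ) (det-Lpow 1ℤ)) d
    pnM′ : PosNeg (r′ ∣∣ M)
    pnM′ = subst PosNeg (sym (∣∣-⊗ r (Lpow 1ℤ) M)) pnM
    pn′ : PosNeg r′
    pn′ = roots⇒PosNeg r′ d′
            (λ neg → PosNeg⇒¬RootNegative (r′ ∣∣ M) (trans (disc-∣∣-SL₂ r′ M (det-LRWord w)) d′) pnM′ (RootNegative-∣∣LRWord w r′ d′ neg))
            (subst RootNegative (sym (negForm-∣∣ r (Lpow 1ℤ))) (RootNegative-∣∣L¹ (negForm r) (PosNeg⇒RootNegative-negForm r d pn)))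
  LRWord⇒UnitSteps (R∷_ {M} w) r d pn pnM =
    subst (Star UnitStep r) (∣∣-⊗ r (Rpow 1ℤ) M) (via-R pn′ ◅ LRWord⇒UnitSteps w r′ d′ pn′ pnM′)
    where
    r′ = r ∣∣ Rpow 1ℤ
    d′ = trans (disc-∣∣-SL₂ r (Rpow 1ℤ) (det-Rpow 1ℤ)) d
    pnM′ : PosNeg (r′ ∣∣ M)
    pnM′ = subst PosNeg (sym (∣∣-⊗ r (Rpow 1ℤ) M)) pnM
    pn′ : PosNeg r′
    pn′ = roots⇒PosNeg r′ d′
            (λ neg → PosNeg⇒¬RootNegative (r′ ∣∣ M) (trans (disc-∣∣-SL₂ r′ M (det-LRWord w)) d′) pnM′ (RootNegative-∣∣LRWord w r′ d′ neg))
            (subst RootNegative (sym (negForm-∣∣ r (Rpow 1ℤ)))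
              (RootNegative-∣∣R¹ (negForm r) (trans (disc-negForm r) d) (PosNeg⇒RootNegative-negForm r d pn)))

  NonNegRelated⇒SameCycle : ∀ r₁ r₂ → disc r₂ ≡ + D → PosNeg r₁ → PosNeg r₂ → NonNegRelated r₁ r₂ → SameCycle (seqL D r₁) (seqL D r₂)
  NonNegRelated⇒SameCycle r₁ r₂ d pn₁ pn₂ (α , β , γ , δ , det , r₁≡r₂M) =
    subst (λ r → SameCycle (seqL D r) (seqL D r₂)) (sym r₁≡r₂M)
      (SameCycle-UnitSteps d pn₂ (LRWord⇒UnitSteps (nonnegSL₂⇒LRWord α β γ δ det) r₂ d pn₂ (subst PosNeg r₁≡r₂M pn₁)))

  ∼⇒SameCycle : ∀ q₁ q₂ → disc q₁ ≡ + D → disc q₂ ≡ + D → q₁ ∼ q₂ → SameCycle (seqL D q₁) (seqL D q₂)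
  ∼⇒SameCycle q₁ q₂ d₁ d₂ q₁∼q₂ = from-reduced (eventually-Reduced q₁ d₁) (eventually-Reduced q₂ d₂)
    where
    from-reduced : ∃[ k ] (Reduced (iterate (stepRL D) q₁ k) × RootAboveOne (iterate (stepRL D) q₁ k)) →
                   ∃[ k ] (Reduced (iterate (stepRL D) q₂ k) × RootAboveOne (iterate (stepRL D) q₂ k)) →
                   SameCycle (seqL D q₁) (seqL D q₂)
    from-reduced (k₁ , (pn₁ , _) , _) (k₂ , (pn₂ , _) , _) =
      SameCycle-trans (SameCycle-iterate D q₁ k₁)
        (SameCycle-trans (reduced-forms (PosNeg-related⇒NonNegRelated M pn₁ pn₂ det-M r₁≡r₂M))
          (SameCycle-sym (SameCycle-iterate D q₂ k₂)))
      where
      r₁ = iterate (stepRL D) q₁ k₁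
      r₂ = iterate (stepRL D) q₂ k₂
      r₁∼r₂ : r₁ ∼ r₂
      r₁∼r₂ = ∼-trans {r₁} {q₁} {r₂} (iterate-stepRL-∼ D q₁ k₁) (∼-trans {q₁} {q₂} {r₂} q₁∼q₂ (∼-sym {r₂} {q₂} (iterate-stepRL-∼ D q₂ k₂)))
      M = proj₁ r₁∼r₂
      det-M = proj₁ (proj₂ r₁∼r₂)
      r₁≡r₂M = proj₂ (proj₂ r₁∼r₂)
      reduced-forms : NonNegRelated r₁ r₂ ⊎ NonNegRelated r₂ r₁ → SameCycle (seqL D r₁) (seqL D r₂)
      reduced-forms (inj₁ rel) = NonNegRelated⇒SameCycle r₁ r₂ (disc-iterate q₂ k₂ d₂) pn₁ pn₂ rel
      reduced-forms (inj₂ rel) = SameCycle-sym (NonNegRelated⇒SameCycle r₂ r₁ (disc-iterate q₁ k₁ d₁) pn₂ pn₁ rel)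

  SameCycle⇒∼ : ∀ q₁ q₂ → disc q₁ ≡ + D → SameCycle (seqL D q₁) (seqL D q₂) → q₁ ∼ q₂
  SameCycle⇒∼ q₁ q₂ d same = from-periodic (seqL-eventuallyPeriodic q₁ d)
    where
    from-periodic : EventuallyPeriodic (seqL D q₁) → q₁ ∼ q₂
    from-periodic (N , p , p>0 , period) =
      common-form (Equivalence.to (same (seqL D q₁ N)) (periodic⇒InCycle (seqL D q₁) N p p>0 period) 0)
      where
      common-form : ∃[ n ] (0 ℕ.≤ n × seqL D q₂ n ≡ seqL D q₁ N) → q₁ ∼ q₂
      common-form (n , _ , q₂ₙ≡f) =
        ∼-trans {q₁} {seqL D q₁ N} {q₂} (∼-sym {seqL D q₁ N} {q₁} (seqL-∼ D q₁ N)) (subst (_∼ q₂) q₂ₙ≡f (seqL-∼ D q₂ n))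

theorem6p15 : (D : ℕ) → 0 ℕ.< D → (∀ m → m ℕ.* m ≢ D) →
    (∀ q → disc q ≡ + D →
        EventuallyPeriodic (reductionSeq D q)
      × (∀ f → InCycle (reductionSeq D q) f → SimplyReduced f × f ∼ q))
    × (∀ q₁ q₂ → disc q₁ ≡ + D → disc q₂ ≡ + D →
        (q₁ ∼ q₂ ⇔ (∀ f → InCycle (reductionSeq D q₁) f ⇔ InCycle (reductionSeq D q₂) f)))
theorem6p15 D _ nonsquare =
  (λ q d → seqL-eventuallyPeriodic D nonsquare q d ,
           λ f f∈cycle → Reduced⇒SimplyReduced f (InCycle⇒Reduced D nonsquare q d f f∈cycle) , InCycle-seqL⇒∼ D q f f∈cycle) ,
  (λ q₁ q₂ d₁ d₂ → mk⇔ (∼⇒SameCycle D nonsquare q₁ q₂ d₁ d₂) (SameCycle⇒∼ D nonsquare q₁ q₂ d₁))
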